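{- (1) If $s,t$ are integers with $s\ge t\ge1$ and $n,r$ are positive integers, then $$\left\lfloor\Bigl(\sum_{k=n}^\infty\frac{1}{\{rk\}_{s,t}}\Bigr)^{ -1}\right\rfloor=\{rn\}_{s,t}-\{r(n-1)\}_{s,t}-\delta_E(r(n-1)).$$ (2) If $s,n,r$ are positive integers, then $$\left\lfloor\Bigl(\sum_{k=n}^\infty\frac{1}{\{rk\}_{s,1}^2}\Bigr)^{ -1}\right\rfloor=\{rn\}_{s,1}^2-\{r(n-1)\}_{s,1}^2-\delta_E(r(n-1)).$$
   Context: For integers $s,t$, $\{n\}_{s,t}$ is defined by $\{0\}_{s,t}=0$, $\{1\}_{s,t}=1$, $\{n\}_{s,t}=s\{n-1\}_{s,t}+t\{n-2\}_{s,t}$ for $n\ge2$. $\lfloor\cdot\rfloor$ is the floor function, and $\delta_E(m)=1$ if $m$ is even and $0$ if $m$ is odd. -}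

module Defs where

open import Data.Nat using (ℕ; zero; suc)
import Data.Nat as ℕ
open import Data.Integer using (ℤ; +_; -[1+_])
import Data.Integer as ℤ
open import Data.Rational using (ℚ; _/_; 0ℚ; 1ℚ; _<_; _≤_)
import Data.Rational as ℚ
open import Data.Product using (_×_; ∃)

U : ℤ → ℤ → ℕ → ℤ
U s t zero = + 0
U s t (suc zero) = + 1
U s t (suc (suc n)) = s ℤ.* U s t (suc n) ℤ.+ t ℤ.* U s t n

δE : ℕ → ℤ
δE zero = + 1
δE (suc zero) = + 0
δE (suc (suc m)) = δE m

-- reciprocal 1/x of an integer as a rational (value at 0 is an
-- irrelevant convention: it is only applied to nonzero terms)
inv : ℤ → ℚ
inv (+ zero) = 0ℚ
inv (+ suc n) = + 1 / suc n
inv -[1+ n ] = -[1+ 0 ] / suc n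

sumFrom : (ℕ → ℚ) → ℕ → ℕ → ℚ
sumFrom f n zero = f n
sumFrom f n (suc N) = f (n ℕ.+ suc N) ℚ.+ sumFrom f n N

-- "⌊ (Σ_{k=n}^∞ f k)^{-1} ⌋ = m" for a series of positive terms
-- with sum S = sup of partial sums:  m ≤ 1/S < m+1  ⇔  m·S ≤ 1 < (m+1)·S,
-- and m·S ≤ 1 ⇔ ∀N, m·P_N ≤ 1 ; 1 < (m+1)·S ⇔ ∃N, 1 < (m+1)·P_N.
FloorInvSum : (ℕ → ℚ) → ℕ → ℤ → Set
FloorInvSum f n m =
  (∀ N → (m / 1) ℚ.* sumFrom f n N ≤ 1ℚ) ×
  ∃ λ N → 1ℚ < ((m ℤ.+ + 1) / 1) ℚ.* sumFrom f n N

-- Write A k = {rk}. Then A (k+2) = V A (k+1) − q A k with V = {r+1} + t{r−1} and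
-- q = (−t)^r, and the Cassini identity A (j+1)² − A j A (j+2) = q^j A 1² holds. With
-- D j = A (j+1) − A j it yields the exact identity
--   (A (j+1) + A (j+2)) D j D (j+2) − A (j+1) A (j+2) (D (j+2) − D j)
--     = q^j A 1² ((V − 1) A (j+2) + (V − q) A (j+1)),
-- whose sign and size give, for M j = D j − δ_E(rj), the telescoping bounds
--   1/(M j + 1) − 1/(M (j+2) + 1) < 1/A (j+1) + 1/A (j+2) ≤ 1/M j − 1/M (j+2).
-- Summed over consecutive pairs they squeeze the tail sum from index j+1 between
-- 1/(M j + 1) and 1/M j. Terms must be paired because for odd r the sign of q^j, and
-- with it δ_E(rj), alternates. For the squares (t = 1) the same works term by term with
-- M j = A (j+1)² − A j² − δ_E(rj), driven by A (j+1)⁴ − A j² A (j+2)² = ±A 1² (A j A (j+2) + A (j+1)²).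

module Submission where

open import Defs
open import Data.Nat as ℕ using (ℕ; zero; suc; _∸_; z≤n; s≤s)
import Data.Nat.Properties as ℕP
open import Data.Nat.Coprimality using (1-coprimeTo)
import Data.Nat.Coprimality as Coprime
open import Data.Integer as ℤ
  using (ℤ; +_; -[1+_]; _+_; _-_; -_; _*_; _^_; _≤_; _<_; _≥_; +≤+; +<+; nonNegative)
import Data.Integer.Properties as ℤP
open import Data.Integer.Tactic.RingSolver using (solve-∀)
open import Data.Rational as ℚ using (ℚ; mkℚ; toℚᵘ; 0ℚ; 1ℚ)
import Data.Rational.Properties as ℚP
open import Data.Rational.Solver using (module +-*-Solver)
import Data.Rational.Unnormalised as ℚᵘ
import Data.Rational.Unnormalised.Properties as ℚᵘP
open import Data.Product using (_×_; _,_; ∃; proj₁; proj₂)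
open import Data.Sum using (_⊎_; inj₁; inj₂)
open import Relation.Binary.PropositionalEquality
  using (_≡_; refl; sym; trans; cong; cong₂; subst; subst₂; module ≡-Reasoning)
open import Relation.Nullary using (yes; no; ¬_; contradiction)

pattern 1≤suc = +≤+ (s≤s z≤n)

≤-by-gap : ∀ {a b} c → b ≡ a + c → + 0 ≤ c → a ≤ b
≤-by-gap {a} c refl 0≤c = subst (_≤ a + c) (ℤP.+-identityʳ a) (ℤP.+-monoʳ-≤ a 0≤c)

<-by-gap : ∀ {a b} c → b ≡ a + c → + 1 ≤ c → a < b
<-by-gap {a} c refl 1≤c = ℤP.suc[i]≤j⇒i<j (subst (_≤ a + c) (ℤP.+-comm a (+ 1)) (ℤP.+-monoʳ-≤ a 1≤c))

+-nonNeg : ∀ {a b} → + 0 ≤ a → + 0 ≤ b → + 0 ≤ a + b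
+-nonNeg = ℤP.+-mono-≤

1≤⇒0≤ : ∀ {a} → + 1 ≤ a → + 0 ≤ a
1≤⇒0≤ = ℤP.≤-trans (+≤+ z≤n)

*-monoˡ-≤-0≤ : ∀ {a b} c → + 0 ≤ c → a ≤ b → c * a ≤ c * b
*-monoˡ-≤-0≤ c 0≤c = ℤP.*-monoˡ-≤-nonNeg c {{nonNegative 0≤c}}

*-monoʳ-≤-0≤ : ∀ {a b} c → + 0 ≤ c → a ≤ b → a * c ≤ b * c
*-monoʳ-≤-0≤ c 0≤c = ℤP.*-monoʳ-≤-nonNeg c {{nonNegative 0≤c}}

*-nonNeg : ∀ {a b} → + 0 ≤ a → + 0 ≤ b → + 0 ≤ a * b
*-nonNeg {a} {b} 0≤a 0≤b = subst (_≤ a * b) (ℤP.*-zeroˡ b) (*-monoʳ-≤-0≤ b 0≤b 0≤a)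

i≤j*i : ∀ {i j} → + 1 ≤ j → + 0 ≤ i → i ≤ j * i
i≤j*i {i} {j} 1≤j 0≤i = subst (_≤ j * i) (ℤP.*-identityˡ i) (*-monoʳ-≤-0≤ i 0≤i 1≤j)

*-≥1 : ∀ {a b} → + 1 ≤ a → + 1 ≤ b → + 1 ≤ a * b
*-≥1 1≤a 1≤b = ℤP.≤-trans 1≤b (i≤j*i 1≤a (1≤⇒0≤ 1≤b))

1≤*⇒1≤ : ∀ {a b} → + 0 ≤ a → + 1 ≤ a * b → + 1 ≤ b
1≤*⇒1≤ {a} {b} 0≤a 1≤ab = ℤP.i<j⇒suc[i]≤j (ℤP.*-cancelˡ-<-nonNeg a {{nonNegative 0≤a}}
  (subst (_< a * b) (sym (ℤP.*-zeroʳ a)) (ℤP.suc[i]≤j⇒i<j 1≤ab)))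

<-of-squares : ∀ {a b} → + 0 ≤ b → a * a < b * b → a < b
<-of-squares {a} {b} 0≤b aa<bb with a ℤP.<? b
... | yes a<b = a<b
... | no a≮b = contradiction aa<bb
  (ℤP.≤⇒≯ (ℤP.≤-trans (*-monoˡ-≤-0≤ b 0≤b b≤a) (*-monoʳ-≤-0≤ a (ℤP.≤-trans 0≤b b≤a) b≤a)))
  where
  b≤a : b ≤ a
  b≤a = ℤP.≮⇒≥ a≮b

1^*-identity : ∀ n a → (+ 1) ^ n * a ≡ a
1^*-identity n a = trans (cong (_* a) (ℤP.^-zeroˡ n)) (ℤP.*-identityˡ a)

^-≥1 : ∀ {a} → + 1 ≤ a → ∀ n → + 1 ≤ a ^ n
^-≥1 1≤a zero = ℤP.≤-refl
^-≥1 1≤a (suc n) = *-≥1 1≤a (^-≥1 1≤a n)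

inv-suc : ∀ n → inv (+ suc n) ≡ mkℚ (+ 1) n (1-coprimeTo (suc n))
inv-suc n = ℚP.normalize-coprime (1-coprimeTo (suc n))

inv-nonNeg : ∀ {a} → + 0 ≤ a → 0ℚ ℚ.≤ inv a
inv-nonNeg {+ zero} _ = ℚP.≤-refl
inv-nonNeg {+ suc n} _ rewrite inv-suc n = ℚ.*≤* (+≤+ z≤n)

inv-antitone : ∀ {a b} → + 1 ≤ a → a ≤ b → inv b ℚ.≤ inv a
inv-antitone {+ suc a} {+ suc b} 1≤suc (+≤+ a≤b) rewrite inv-suc a | inv-suc b =
  ℚ.*≤* (subst₂ _≤_ (sym (ℤP.*-identityˡ _)) (sym (ℤP.*-identityˡ _)) (+≤+ a≤b))

/1*inv≡1 : ∀ n → (+ suc n ℚ./ 1) ℚ.* inv (+ suc n) ≡ 1ℚ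
/1*inv≡1 n = ℚP.toℚᵘ-injective (begin
  toℚᵘ ((+ suc n ℚ./ 1) ℚ.* inv (+ suc n))            ≈⟨ ℚP.toℚᵘ-homo-* (+ suc n ℚ./ 1) (inv (+ suc n)) ⟩
  toℚᵘ (+ suc n ℚ./ 1) ℚᵘ.* toℚᵘ (inv (+ suc n))      ≡⟨ cong₂ (λ x y → toℚᵘ x ℚᵘ.* toℚᵘ y) n/1 (inv-suc n) ⟩
  ℚᵘ.mkℚᵘ (+ suc n) 0 ℚᵘ.* ℚᵘ.mkℚᵘ (+ 1) n            ≈⟨ ℚᵘ.*≡* (trans (ℤP.*-identityʳ _) (trans (ℤP.*-identityʳ _)
                                                             (sym (trans (ℤP.*-identityˡ _) (cong (λ m → + suc m) (ℕP.+-identityʳ n)))))) ⟩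
  toℚᵘ 1ℚ ∎)
  where
  open ℚᵘP.≃-Reasoning
  n/1 : + suc n ℚ./ 1 ≡ mkℚ (+ suc n) 0 _
  n/1 = ℚP.normalize-coprime (Coprime.sym (1-coprimeTo (suc n)))

-- p/(d+1) ≥ 1/(d+1) > 1/(d+2)
archimedean-inv : ∀ g → 0ℚ ℚ.< g → ∃ λ J → inv (+ suc J) ℚ.< g
archimedean-inv g@(mkℚ (+ suc p) d _) _ = suc d , subst (ℚ._< g) (sym (inv-suc (suc d)))
  (ℚ.*<* (subst₂ _<_ (sym (ℤP.*-identityˡ _)) refl (+<+ (ℕP.m≤m+n (suc (suc d)) (p ℕ.* suc (suc d))))))
archimedean-inv (mkℚ (+ zero) _ _) (ℚ.*<* (+<+ ()))
archimedean-inv (mkℚ -[1+ _ ] _ _) (ℚ.*<* ())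

toℚᵘ-inv : ∀ n → toℚᵘ (inv (+ suc n)) ≡ ℚᵘ.mkℚᵘ (+ 1) n
toℚᵘ-inv n = cong toℚᵘ (inv-suc n)

toℚᵘ-inv-+ : ∀ a b → toℚᵘ (inv (+ suc a) ℚ.+ inv (+ suc b)) ℚᵘ.≃ ℚᵘ.mkℚᵘ (+ 1) a ℚᵘ.+ ℚᵘ.mkℚᵘ (+ 1) b
toℚᵘ-inv-+ a b = ℚᵘP.≃-trans (ℚP.toℚᵘ-homo-+ (inv (+ suc a)) (inv (+ suc b)))
  (ℚᵘP.≃-reflexive (cong₂ ℚᵘ._+_ (toℚᵘ-inv a) (toℚᵘ-inv b)))

toℚᵘ-inv-- : ∀ c d → toℚᵘ (inv (+ suc c) ℚ.- inv (+ suc d)) ℚᵘ.≃ ℚᵘ.mkℚᵘ (+ 1) c ℚᵘ.- ℚᵘ.mkℚᵘ (+ 1) d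
toℚᵘ-inv-- c d = ℚᵘP.≃-trans (ℚP.toℚᵘ-homo-+ (inv (+ suc c)) (ℚ.- inv (+ suc d)))
  (ℚᵘP.+-cong (ℚᵘP.≃-reflexive (toℚᵘ-inv c))
    (ℚᵘP.≃-trans (ℚP.toℚᵘ-homo‿- (inv (+ suc d))) (ℚᵘP.≃-reflexive (cong ℚᵘ.-_ (toℚᵘ-inv d)))))

≤-by-cross-multiplication : ∀ {x y p q} → toℚᵘ x ℚᵘ.≃ p → toℚᵘ y ℚᵘ.≃ q →
                            ℚᵘ.↥ p * ℚᵘ.↧ q ≤ ℚᵘ.↥ q * ℚᵘ.↧ p → x ℚ.≤ y
≤-by-cross-multiplication x≃p y≃q h =
  ℚP.toℚᵘ-cancel-≤ (ℚᵘP.≤-respˡ-≃ (ℚᵘP.≃-sym x≃p) (ℚᵘP.≤-respʳ-≃ (ℚᵘP.≃-sym y≃q) (ℚᵘ.*≤* h)))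

<-by-cross-multiplication : ∀ {x y p q} → toℚᵘ x ℚᵘ.≃ p → toℚᵘ y ℚᵘ.≃ q →
                            ℚᵘ.↥ p * ℚᵘ.↧ q < ℚᵘ.↥ q * ℚᵘ.↧ p → x ℚ.< y
<-by-cross-multiplication x≃p y≃q h =
  ℚP.toℚᵘ-cancel-< (ℚᵘP.<-respˡ-≃ (ℚᵘP.≃-sym x≃p) (ℚᵘP.<-respʳ-≃ (ℚᵘP.≃-sym y≃q) (ℚᵘ.*<* h)))

private
  sum-cross : ∀ A B C D → (A + B) * C * D ≡ (+ 1 * B + + 1 * A) * (C * D)
  sum-cross = solve-∀

  diff-cross : ∀ A B C D → A * B * (D - C) ≡ (+ 1 * D + (- + 1) * C) * (A * B)
  diff-cross = solve-∀

  one-cross : ∀ C D → C * D ≡ + 1 * (C * D)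
  one-cross = solve-∀

  one-diff-cross : ∀ A C D → A * (D - C) ≡ (+ 1 * D + (- + 1) * C) * A
  one-diff-cross = solve-∀

inv-+≤inv-- : ∀ {A B C D} → + 1 ≤ A → + 1 ≤ B → + 1 ≤ C → + 1 ≤ D →
              (A + B) * C * D ≤ A * B * (D - C) → inv A ℚ.+ inv B ℚ.≤ inv C ℚ.- inv D
inv-+≤inv-- {A@(+ suc a)} {B@(+ suc b)} {C@(+ suc c)} {D@(+ suc d)} 1≤suc 1≤suc 1≤suc 1≤suc h =
  ≤-by-cross-multiplication (toℚᵘ-inv-+ a b) (toℚᵘ-inv-- c d) (subst₂ _≤_
    (trans (sum-cross A B C D) (cong ((+ 1 * B + + 1 * A) *_) (sym (ℤP.pos-* (suc c) (suc d)))))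
    (trans (diff-cross A B C D) (cong ((+ 1 * D + (- + 1) * C) *_) (sym (ℤP.pos-* (suc a) (suc b))))) h)

inv--<inv-+ : ∀ {A B C D} → + 1 ≤ A → + 1 ≤ B → + 1 ≤ C → + 1 ≤ D →
              A * B * (D - C) < (A + B) * C * D → inv C ℚ.- inv D ℚ.< inv A ℚ.+ inv B
inv--<inv-+ {A@(+ suc a)} {B@(+ suc b)} {C@(+ suc c)} {D@(+ suc d)} 1≤suc 1≤suc 1≤suc 1≤suc h =
  <-by-cross-multiplication (toℚᵘ-inv-- c d) (toℚᵘ-inv-+ a b) (subst₂ _<_
    (trans (diff-cross A B C D) (cong ((+ 1 * D + (- + 1) * C) *_) (sym (ℤP.pos-* (suc a) (suc b)))))
    (trans (sum-cross A B C D) (cong ((+ 1 * B + + 1 * A) *_) (sym (ℤP.pos-* (suc c) (suc d))))) h)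

inv≤inv-- : ∀ {A C D} → + 1 ≤ A → + 1 ≤ C → + 1 ≤ D →
            C * D ≤ A * (D - C) → inv A ℚ.≤ inv C ℚ.- inv D
inv≤inv-- {A@(+ suc a)} {C@(+ suc c)} {D@(+ suc d)} 1≤suc 1≤suc 1≤suc h =
  ≤-by-cross-multiplication (ℚᵘP.≃-reflexive (toℚᵘ-inv a)) (toℚᵘ-inv-- c d) (subst₂ _≤_
    (trans (one-cross C D) (cong (+ 1 *_) (sym (ℤP.pos-* (suc c) (suc d)))))
    (one-diff-cross A C D) h)

inv--<inv : ∀ {A C D} → + 1 ≤ A → + 1 ≤ C → + 1 ≤ D →
            A * (D - C) < C * D → inv C ℚ.- inv D ℚ.< inv A
inv--<inv {A@(+ suc a)} {C@(+ suc c)} {D@(+ suc d)} 1≤suc 1≤suc 1≤suc h =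
  <-by-cross-multiplication (toℚᵘ-inv-- c d) (ℚᵘP.≃-reflexive (toℚᵘ-inv a)) (subst₂ _<_
    (one-diff-cross A C D)
    (trans (one-cross C D) (cong (+ 1 *_) (sym (ℤP.pos-* (suc c) (suc d))))) h)

-- Squeezing a series between telescoping bounds on pairs of terms

double : ℕ → ℕ
double zero = zero
double (suc j) = suc (suc (double j))

telescope : ∀ a b c → (a ℚ.- b) ℚ.+ (b ℚ.- c) ≡ a ℚ.- c
telescope = solve 3 (λ a b c → (a :- b) :+ (b :- c) := a :- c) refl
  where open +-*-Solver

private
  regroup : ∀ x y s → s ℚ.+ (x ℚ.+ y) ≡ y ℚ.+ (x ℚ.+ s)
  regroup = solve 3 (λ x y s → s :+ (x :+ y) := y :+ (x :+ s)) refl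
    where open +-*-Solver

  telescope-after : ∀ a b c d → (a ℚ.+ (b ℚ.- c)) ℚ.+ (c ℚ.- d) ≡ a ℚ.+ (b ℚ.- d)
  telescope-after = solve 4 (λ a b c d → (a :+ (b :- c)) :+ (c :- d) := a :+ (b :- d)) refl
    where open +-*-Solver

  reassociate : ∀ a b c → (a ℚ.+ b) ℚ.- c ≡ a ℚ.+ (b ℚ.- c)
  reassociate = solve 3 (λ a b c → (a :+ b) :- c := a :+ (b :- c)) refl
    where open +-*-Solver

  complement : ∀ a b c → a ≡ (b ℚ.+ c) ℚ.- (b ℚ.- (a ℚ.- c))
  complement = solve 3 (λ a b c → a := (b :+ c) :- (b :- (a :- c))) refl
    where open +-*-Solver

n≤suc-double : ∀ n → n ℕ.≤ suc (double n)
n≤suc-double zero = z≤n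
n≤suc-double (suc n) = s≤s (ℕP.≤-trans (n≤suc-double n) (ℕP.n≤1+n _))

p-q≤p : ∀ {p q} → 0ℚ ℚ.≤ q → p ℚ.- q ℚ.≤ p
p-q≤p {p} 0≤q = subst (p ℚ.- _ ℚ.≤_) (ℚP.+-identityʳ p) (ℚP.+-monoʳ-≤ p (ℚP.neg-antimono-≤ 0≤q))

*≤1-from-≤inv : ∀ {m S} → + 0 ≤ m → (+ 1 ≤ m → S ℚ.≤ inv m) → (m ℚ./ 1) ℚ.* S ℚ.≤ 1ℚ
*≤1-from-≤inv {+ zero} {S} _ _ = subst (ℚ._≤ 1ℚ) (sym (ℚP.*-zeroˡ S)) (ℚ.*≤* (+≤+ z≤n))
*≤1-from-≤inv {+ suc m} {S} _ S≤ = subst ((+ suc m ℚ./ 1) ℚ.* S ℚ.≤_) (/1*inv≡1 m)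
  (ℚP.*-monoˡ-≤-nonNeg (+ suc m ℚ./ 1) {{ℚP.normalize-nonNeg (suc m) 1}} (S≤ 1≤suc))

1<*-from-inv< : ∀ {m S} → + 1 ≤ m → inv m ℚ.< S → 1ℚ ℚ.< (m ℚ./ 1) ℚ.* S
1<*-from-inv< {+ suc m} {S} 1≤suc <S = subst (ℚ._< (+ suc m ℚ./ 1) ℚ.* S) (/1*inv≡1 m)
  (ℚP.*-monoʳ-<-pos (+ suc m ℚ./ 1) {{ℚP.normalize-pos (suc m) 1}} <S)

module _ (f : ℕ → ℚ) (f-nonNeg : ∀ k → 0ℚ ℚ.≤ f k) where

  sumFrom-≤-suc : ∀ n N → sumFrom f n N ℚ.≤ sumFrom f n (suc N)
  sumFrom-≤-suc n N = subst (ℚ._≤ sumFrom f n (suc N)) (ℚP.+-identityˡ (sumFrom f n N))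
    (ℚP.+-monoˡ-≤ (sumFrom f n N) (f-nonNeg (n ℕ.+ suc N)))

  sumFrom-mono : ∀ n {N N′} → N ℕ.≤ N′ → sumFrom f n N ℚ.≤ sumFrom f n N′
  sumFrom-mono n {N′ = zero} z≤n = ℚP.≤-refl
  sumFrom-mono n {N′ = suc N′} N≤ with ℕP.m≤n⇒m<n∨m≡n N≤
  ... | inj₁ (s≤s N≤N′) = ℚP.≤-trans (sumFrom-mono n N≤N′) (sumFrom-≤-suc n N′)
  ... | inj₂ refl       = ℚP.≤-refl

-- Summing the pair bounds gives 1/(M 0 + 1) < Σ f ≤ 1/M 0; the lower bound survives the
-- limit because it is strict on the first pair while M (2j) → ∞ on the others.
module FloorCriterion (f : ℕ → ℚ) (M : ℕ → ℤ)
  (f-nonNeg : ∀ i → 0ℚ ℚ.≤ f i)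
  (M-nonNeg : ∀ i → + 0 ≤ M i)
  (M-mono₂ : ∀ i → M i ≤ M (2 ℕ.+ i))
  (M-growth : ∀ i → M (2 ℕ.+ i) + + 1 ≤ M (4 ℕ.+ i))
  (pair-upper : ∀ i → + 1 ≤ M i → f i ℚ.+ f (1 ℕ.+ i) ℚ.≤ inv (M i) ℚ.- inv (M (2 ℕ.+ i)))
  (pair-lower : ∀ i → inv (M i + + 1) ℚ.- inv (M (2 ℕ.+ i) + + 1) ℚ.< f i ℚ.+ f (1 ℕ.+ i))
  where

  private
    S : ℕ → ℚ
    S = sumFrom f 0

    F X : ℚ
    F = f 0 ℚ.+ f 1
    X = inv (M 2 + + 1)

    first-pair : S 1 ≡ F
    first-pair = ℚP.+-comm (f 1) (f 0)

  M₀≤M-double : ∀ j → M 0 ≤ M (double j)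
  M₀≤M-double zero = ℤP.≤-refl
  M₀≤M-double (suc j) = ℤP.≤-trans (M₀≤M-double j) (M-mono₂ (double j))

  M-double-linear : ∀ j → M 2 + + j ≤ M (double (suc j))
  M-double-linear zero = ℤP.≤-reflexive (ℤP.+-identityʳ (M 2))
  M-double-linear (suc j) = begin
    M 2 + + suc j             ≡⟨ cong (λ k → M 2 + k) (ℤP.+-comm (+ 1) (+ j)) ⟩
    M 2 + (+ j + + 1)         ≡⟨ ℤP.+-assoc (M 2) (+ j) (+ 1) ⟨
    M 2 + + j + + 1           ≤⟨ ℤP.+-monoˡ-≤ (+ 1) (M-double-linear j) ⟩
    M (double (suc j)) + + 1  ≤⟨ M-growth (double j) ⟩
    M (double (suc (suc j)))  ∎
    where open ℤP.≤-Reasoning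

  suc≤M-double+1 : ∀ j → + suc j ≤ M (double (suc j)) + + 1
  suc≤M-double+1 j = begin
    + suc j                       ≡⟨ ℤP.+-comm (+ 1) (+ j) ⟩
    + j + + 1                     ≤⟨ ℤP.+-monoˡ-≤ (+ 1) (ℤP.+-monoˡ-≤ (+ j) (M-nonNeg 2)) ⟩
    M 2 + + j + + 1               ≤⟨ ℤP.+-monoˡ-≤ (+ 1) (M-double-linear j) ⟩
    M (double (suc j)) + + 1      ∎
    where open ℤP.≤-Reasoning

  pairs-upper : + 1 ≤ M 0 → ∀ j → S (suc (double j)) ℚ.≤ inv (M 0) ℚ.- inv (M (double (suc j)))
  pairs-upper 1≤M₀ zero = subst (ℚ._≤ _) (sym first-pair) (pair-upper 0 1≤M₀)
  pairs-upper 1≤M₀ (suc j) = begin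
    S (suc (double (suc j)))
      ≡⟨ regroup (f (2 ℕ.+ double j)) (f (3 ℕ.+ double j)) (S (suc (double j))) ⟨
    S (suc (double j)) ℚ.+ (f (2 ℕ.+ double j) ℚ.+ f (3 ℕ.+ double j))
      ≤⟨ ℚP.+-mono-≤ (pairs-upper 1≤M₀ j) (pair-upper (2 ℕ.+ double j) (ℤP.≤-trans 1≤M₀ (M₀≤M-double (suc j)))) ⟩
    (inv (M 0) ℚ.- inv (M (double (suc j)))) ℚ.+ (inv (M (double (suc j))) ℚ.- inv (M (double (suc (suc j)))))
      ≡⟨ telescope (inv (M 0)) _ _ ⟩
    inv (M 0) ℚ.- inv (M (double (suc (suc j))))
      ∎
    where open ℚP.≤-Reasoning

  pairs-lower : ∀ j → F ℚ.+ (X ℚ.- inv (M (double (suc j)) + + 1)) ℚ.≤ S (suc (double j))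
  pairs-lower zero = ℚP.≤-reflexive (begin-equality
    F ℚ.+ (X ℚ.- X)  ≡⟨ cong (F ℚ.+_) (ℚP.+-inverseʳ X) ⟩
    F ℚ.+ 0ℚ         ≡⟨ ℚP.+-identityʳ F ⟩
    F                ≡⟨ first-pair ⟨
    S 1              ∎)
    where open ℚP.≤-Reasoning
  pairs-lower (suc j) = begin
    F ℚ.+ (X ℚ.- inv (M (double (suc (suc j))) + + 1))
      ≡⟨ telescope-after F X (inv (M (double (suc j)) + + 1)) _ ⟨
    (F ℚ.+ (X ℚ.- inv (M (double (suc j)) + + 1))) ℚ.+ (inv (M (double (suc j)) + + 1) ℚ.- inv (M (double (suc (suc j))) + + 1))
      ≤⟨ ℚP.+-mono-≤ (pairs-lower j) (ℚP.<⇒≤ (pair-lower (2 ℕ.+ double j))) ⟩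
    S (suc (double j)) ℚ.+ (f (2 ℕ.+ double j) ℚ.+ f (3 ℕ.+ double j))
      ≡⟨ regroup (f (2 ℕ.+ double j)) (f (3 ℕ.+ double j)) (S (suc (double j))) ⟩
    S (suc (double (suc j)))  ∎
    where open ℚP.≤-Reasoning

  upper : ∀ N → (M 0 ℚ./ 1) ℚ.* S N ℚ.≤ 1ℚ
  upper N = *≤1-from-≤inv (M-nonNeg 0) λ 1≤M₀ → begin
    S N                                           ≤⟨ sumFrom-mono f f-nonNeg 0 (n≤suc-double N) ⟩
    S (suc (double N))                            ≤⟨ pairs-upper 1≤M₀ N ⟩
    inv (M 0) ℚ.- inv (M (double (suc N)))        ≤⟨ p-q≤p (inv-nonNeg (M-nonNeg (double (suc N)))) ⟩
    inv (M 0)                                     ∎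
    where open ℚP.≤-Reasoning

  lower : ∃ λ N → 1ℚ ℚ.< ((M 0 + + 1) ℚ./ 1) ℚ.* S N
  lower = suc (double J) , 1<*-from-inv< 1≤M₀+1 (begin-strict
    I                                ≡⟨ complement I F X ⟩
    (F ℚ.+ X) ℚ.- g                  <⟨ ℚP.+-monoʳ-< (F ℚ.+ X) (ℚP.neg-antimono-< W<g) ⟩
    (F ℚ.+ X) ℚ.- W                  ≡⟨ reassociate F X W ⟩
    F ℚ.+ (X ℚ.- W)                  ≤⟨ pairs-lower J ⟩
    S (suc (double J))               ∎)
    where
    open ℚP.≤-Reasoning
    I g : ℚ
    I = inv (M 0 + + 1)
    g = F ℚ.- (I ℚ.- X)

    g-pos : 0ℚ ℚ.< g
    g-pos = subst (ℚ._< g) (ℚP.+-inverseʳ (I ℚ.- X)) (ℚP.+-monoˡ-< (ℚ.- (I ℚ.- X)) (pair-lower 0))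

    J : ℕ
    J = proj₁ (archimedean-inv g g-pos)

    W : ℚ
    W = inv (M (double (suc J)) + + 1)

    1≤M₀+1 : + 1 ≤ M 0 + + 1
    1≤M₀+1 = ℤP.+-monoˡ-≤ (+ 1) (M-nonNeg 0)

    W<g : W ℚ.< g
    W<g = ℚP.≤-<-trans (inv-antitone 1≤suc (suc≤M-double+1 J)) (proj₂ (archimedean-inv g g-pos))

  floorInvSum : FloorInvSum f 0 (M 0)
  floorInvSum = upper , lower

sumFrom-shift : ∀ {f g} n → (∀ i → g i ≡ f (i ℕ.+ n)) → ∀ N → sumFrom g 0 N ≡ sumFrom f n N
sumFrom-shift n g≗ zero = g≗ 0
sumFrom-shift {f} n g≗ (suc N) =
  cong₂ ℚ._+_ (trans (g≗ (suc N)) (cong f (ℕP.+-comm (suc N) n))) (sumFrom-shift n g≗ N)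

FloorInvSum-shift : ∀ {f g n m} → (∀ i → g i ≡ f (i ℕ.+ n)) → FloorInvSum g 0 m → FloorInvSum f n m
FloorInvSum-shift {n = n} {m} g≗ (upper , N , lower) =
  (λ N → subst (λ S → (m ℚ./ 1) ℚ.* S ℚ.≤ 1ℚ) (sumFrom-shift n g≗ N) (upper N)) ,
  N , subst (λ S → 1ℚ ℚ.< ((m + + 1) ℚ./ 1) ℚ.* S) (sumFrom-shift n g≗ N) lower

δE-suc : ∀ m → δE (suc m) ≡ + 1 - δE m
δE-suc zero = refl
δE-suc (suc zero) = refl
δE-suc (suc (suc m)) = δE-suc m

δE-+-even : ∀ a b → δE a ≡ + 1 → δE (a ℕ.+ b) ≡ δE b
δE-+-even zero b _ = refl
δE-+-even (suc zero) b ()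
δE-+-even (suc (suc a)) b h = δE-+-even a b h

δE-+-odd : ∀ a b → δE a ≡ + 0 → δE (a ℕ.+ b) ≡ + 1 - δE b
δE-+-odd zero b ()
δE-+-odd (suc zero) b _ = δE-suc b
δE-+-odd (suc (suc a)) b h = δE-+-odd a b h

δE-*-zero : ∀ r → δE (r ℕ.* 0) ≡ + 1
δE-*-zero r = cong δE (ℕP.*-zeroʳ r)

δE-*-even : ∀ r → δE r ≡ + 1 → ∀ j → δE (r ℕ.* j) ≡ + 1
δE-*-even r h zero = δE-*-zero r
δE-*-even r h (suc j) = begin
  δE (r ℕ.* suc j)      ≡⟨ cong δE (ℕP.*-suc r j) ⟩
  δE (r ℕ.+ r ℕ.* j)    ≡⟨ δE-+-even r (r ℕ.* j) h ⟩
  δE (r ℕ.* j)          ≡⟨ δE-*-even r h j ⟩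
  + 1                   ∎
  where open ≡-Reasoning

δE-*-odd : ∀ r → δE r ≡ + 0 → ∀ j → δE (r ℕ.* j) ≡ δE j
δE-*-odd r h zero = δE-*-zero r
δE-*-odd r h (suc j) = begin
  δE (r ℕ.* suc j)          ≡⟨ cong δE (ℕP.*-suc r j) ⟩
  δE (r ℕ.+ r ℕ.* j)        ≡⟨ δE-+-odd r (r ℕ.* j) h ⟩
  + 1 - δE (r ℕ.* j)        ≡⟨ cong (_-_ (+ 1)) (δE-*-odd r h j) ⟩
  + 1 - δE j                ≡⟨ δE-suc j ⟨
  δE (suc j)                ∎
  where open ≡-Reasoning

-^-parity : ∀ t r → (δE r ≡ + 1 × (- t) ^ r ≡ t ^ r) ⊎ (δE r ≡ + 0 × (- t) ^ r ≡ - (t ^ r))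
-^-parity t zero = inj₁ (refl , refl)
-^-parity t (suc r) with -^-parity t r
... | inj₁ (even , eq) = inj₂ (trans (δE-suc r) (cong (_-_ (+ 1)) even) , trans (cong ((- t) *_) eq) (sym (ℤP.neg-distribˡ-* t (t ^ r))))
... | inj₂ (odd , eq) = inj₁ (trans (δE-suc r) (cong (_-_ (+ 1)) odd) , trans (cong ((- t) *_) eq) (neg-*-neg t (t ^ r)))
  where
  neg-*-neg : ∀ a b → (- a) * (- b) ≡ a * b
  neg-*-neg = solve-∀

-- Second-order recurrences and the multisections of {n}_{s,t}

-- With V = lucas r and q = (−t)^r, A k is {rk}_{s,t} (U-multiple below).
module Recurrence (V q u : ℤ) where

  A : ℕ → ℤ
  A zero = + 0
  A (suc zero) = u
  A (suc (suc k)) = V * A (suc k) - q * A k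

  gap : ℕ → ℤ
  gap j = A (suc j) - A j

  cassini : ℕ → ℤ
  cassini j = A (suc j) * A (suc j) - A j * A (2 ℕ.+ j)

  cassini-zero : cassini 0 ≡ u * u
  cassini-zero = lemma u (A 2)
    where
    lemma : ∀ u a → u * u - + 0 * a ≡ u * u
    lemma = solve-∀

  cassini-suc : ∀ j → cassini (suc j) ≡ q * cassini j
  cassini-suc j = lemma V q (A j) (A (suc j))
    where
    lemma : ∀ V q x y → (V * y - q * x) * (V * y - q * x) - y * (V * (V * y - q * x) - q * y) ≡ q * (y * y - x * (V * y - q * x))
    lemma = solve-∀

  cassini-closed : ∀ j → cassini j ≡ q ^ j * (u * u)
  cassini-closed zero = trans cassini-zero (sym (ℤP.*-identityˡ (u * u)))
  cassini-closed (suc j) = trans (cassini-suc j) (trans (cong (q *_) (cassini-closed j)) (sym (ℤP.*-assoc q (q ^ j) (u * u))))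

  gap-zero : gap 0 ≡ u
  gap-zero = ℤP.+-identityʳ u

  gap-one : gap 1 ≡ (V - + 1) * u
  gap-one = lemma V q u
    where
    lemma : ∀ V q u → (V * u - q * + 0) - u ≡ (V - + 1) * u
    lemma = solve-∀

  initial-cassini-bound : ∀ Q → u * u * (V + Q) ≤ u * (V * V - V - q + + 1) - + 1 →
                          Q ^ 0 * (u * u) * (V + Q) ≤ gap 0 + gap 2 - + 1
  initial-cassini-bound Q = subst₂ _≤_ (cong (_* (V + Q)) (sym (ℤP.*-identityˡ (u * u)))) (lemma V q u)
    where
    lemma : ∀ V q u → u * (V * V - V - q + + 1) - + 1 ≡ (u - + 0) + ((V * (V * u - q * + 0) - q * u) - (V * u - q * + 0)) - + 1
    lemma = solve-∀

  gap-rec : ∀ j → gap (2 ℕ.+ j) ≡ V * gap (suc j) - q * gap j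
  gap-rec j = lemma V q (A j) (A (suc j))
    where
    lemma : ∀ V q x y → (V * (V * y - q * x) - q * y) - (V * y - q * x) ≡ V * ((V * y - q * x) - y) - q * (y - x)
    lemma = solve-∀

  A-suc : ∀ j → A (suc j) ≡ A j + gap j
  A-suc j = lemma (A j) (A (suc j))
    where
    lemma : ∀ x y → y ≡ x + (y - x)
    lemma = solve-∀

  pair-weight : ℕ → ℤ
  pair-weight j = (V - + 1) * A (2 ℕ.+ j) + (V - q) * A (suc j)

  defect : ℕ → ℤ
  defect j = (A (suc j) + A (2 ℕ.+ j)) * gap j * gap (2 ℕ.+ j) - A (suc j) * A (2 ℕ.+ j) * (gap (2 ℕ.+ j) - gap j)

  pair-defect : ∀ j → defect j ≡ cassini j * pair-weight j
  pair-defect j = lemma V q (A j) (A (suc j))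
    where
    lemma : ∀ V q x y → let z = V * y - q * x ; w = V * z - q * y in
      (y + z) * (y - x) * (w - z) - y * z * ((w - z) - (y - x)) ≡ (y * y - x * z) * ((V - + 1) * z + (V - q) * y)
    lemma = solve-∀

module _ (s t : ℤ) where

  U-+ : ∀ j m → U s t (m ℕ.+ suc j) ≡ t * U s t j * U s t m + U s t (suc j) * U s t (suc m)
  U-+ j zero = lemma t (U s t j) (U s t (suc j))
    where
    lemma : ∀ t a b → b ≡ t * a * + 0 + b * + 1
    lemma = solve-∀
  U-+ j (suc zero) = lemma s t (U s t j) (U s t (suc j))
    where
    lemma : ∀ s t a b → s * b + t * a ≡ t * a * + 1 + b * (s * + 1 + t * + 0)
    lemma = solve-∀
  U-+ j (suc (suc m)) =
    trans (cong₂ (λ a b → s * a + t * b) (U-+ j (suc m)) (U-+ j m))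
          (lemma s t (U s t j) (U s t (suc j)) (U s t m) (U s t (suc m)))
    where
    lemma : ∀ s t a b c d → s * (t * a * d + b * (s * d + t * c)) + t * (t * a * c + b * d)
                          ≡ t * a * (s * d + t * c) + b * (s * (s * d + t * c) + t * d)
    lemma = solve-∀

  U-cassini : ∀ r → t * (U s t r * U s t (2 ℕ.+ r) - U s t (suc r) * U s t (suc r)) ≡ (- t) ^ suc r
  U-cassini zero = lemma s t
    where
    lemma : ∀ s t → t * (+ 0 * (s * + 1 + t * + 0) - + 1 * + 1) ≡ (- t) * + 1
    lemma = solve-∀
  U-cassini (suc r) = trans (lemma s t (U s t r) (U s t (suc r))) (cong ((- t) *_) (U-cassini r))
    where
    lemma : ∀ s t a b → t * (b * (s * (s * b + t * a) + t * b) - (s * b + t * a) * (s * b + t * a))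
                      ≡ (- t) * (t * (a * (s * b + t * a) - b * b))
    lemma = solve-∀

  -- The Lucas companion {r+1} + t{r−1}; only used for r ≥ 1, as r ∸ 1 truncates.
  lucas : ℕ → ℤ
  lucas r = t * U s t (r ℕ.∸ 1) + U s t (suc r)

  U-step : ∀ r′ m → let r = suc r′ in
           U s t ((m ℕ.+ r) ℕ.+ r) ≡ lucas r * U s t (m ℕ.+ r) - (- t) ^ r * U s t m
  U-step r′ m = begin
    u ((m ℕ.+ r) ℕ.+ r)
      ≡⟨ U-+ r′ (m ℕ.+ r) ⟩
    t * u r′ * u (m ℕ.+ r) + u r * u (suc (m ℕ.+ r))
      ≡⟨ cong₂ (λ a b → t * u r′ * a + u r * b) (U-+ r′ m) (U-+ r′ (suc m)) ⟩
    t * u r′ * (t * u r′ * u m + u r * u (suc m)) + u r * (t * u r′ * u (suc m) + u r * (s * u (suc m) + t * u m))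
      ≡⟨ lemma s t (u r′) (u r) (u m) (u (suc m)) ⟩
    lucas r * (t * u r′ * u m + u r * u (suc m)) - t * (u r′ * u (suc r) - u r * u r) * u m
      ≡⟨ cong₂ (λ a b → lucas r * a - b * u m) (sym (U-+ r′ m)) (U-cassini r′) ⟩
    lucas r * u (m ℕ.+ r) - (- t) ^ r * u m ∎
    where
    open ≡-Reasoning
    r = suc r′
    u = U s t
    lemma : ∀ s t a b c d → t * a * (t * a * c + b * d) + b * (t * a * d + b * (s * d + t * c))
                          ≡ (t * a + (s * b + t * a)) * (t * a * c + b * d) - t * (a * (s * b + t * a) - b * b) * c
    lemma = solve-∀

  U-multiple : ∀ r′ k → let r = suc r′ in U s t (r ℕ.* k) ≡ Recurrence.A (lucas r) ((- t) ^ r) (U s t r) k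
  U-multiple r′ zero = cong (U s t) (ℕP.*-zeroʳ (suc r′))
  U-multiple r′ (suc zero) = cong (U s t) (ℕP.*-identityʳ (suc r′))
  U-multiple r′ (suc (suc k)) = begin
    U s t (r ℕ.* suc (suc k))
      ≡⟨ cong (U s t) (trans (*-suc′ r (suc k)) (cong (ℕ._+ r) (*-suc′ r k))) ⟩
    U s t ((r ℕ.* k ℕ.+ r) ℕ.+ r)
      ≡⟨ U-step r′ (r ℕ.* k) ⟩
    lucas r * U s t (r ℕ.* k ℕ.+ r) - (- t) ^ r * U s t (r ℕ.* k)
      ≡⟨ cong₂ (λ a b → lucas r * a - (- t) ^ r * b)
           (trans (cong (U s t) (sym (*-suc′ r k))) (U-multiple r′ (suc k))) (U-multiple r′ k) ⟩
    Recurrence.A (lucas r) ((- t) ^ r) (U s t r) (suc (suc k)) ∎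
    where
    open ≡-Reasoning
    r = suc r′
    *-suc′ : ∀ m n → m ℕ.* suc n ≡ m ℕ.* n ℕ.+ m
    *-suc′ m n = trans (ℕP.*-suc m n) (ℕP.+-comm m (m ℕ.* n))

  lucas-square : ∀ r′ → let r = suc r′ in
    lucas r * lucas r ≡ (s * s + + 4 * t) * U s t r * U s t r + + 4 * (- t) ^ r
  lucas-square r′ = trans (lemma s t (U s t r′) (U s t (suc r′)))
    (cong (λ c → (s * s + + 4 * t) * U s t (suc r′) * U s t (suc r′) + + 4 * c) (U-cassini r′))
    where
    lemma : ∀ s t p w → (t * p + (s * w + t * p)) * (t * p + (s * w + t * p)) ≡
      (s * s + + 4 * t) * w * w + + 4 * (t * (p * (s * w + t * p) - w * w))
    lemma = solve-∀

δE≤1 : ∀ m → δE m ≤ + 1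
δE≤1 zero = ℤP.≤-refl
δE≤1 (suc zero) = +≤+ z≤n
δE≤1 (suc (suc m)) = δE≤1 m

-- Pair bounds for the sums of 1/{rk}

pair-upper-ℤ : ∀ y z D₁ D₃ a {m₁ m₃} → m₁ ≡ D₁ - a → m₃ ≡ D₃ - a →
               (y + z) * D₁ * D₃ - y * z * (D₃ - D₁) ≤ a * (y + z) * (D₁ + D₃ - a) →
               (y + z) * m₁ * m₃ ≤ y * z * (m₃ - m₁)
pair-upper-ℤ y z D₁ D₃ a m₁≡ m₃≡ h = subst₂ (λ m₁ m₃ → (y + z) * m₁ * m₃ ≤ y * z * (m₃ - m₁)) (sym m₁≡) (sym m₃≡)
  (≤-by-gap _ (lemma y z D₁ D₃ a) (ℤP.i≤j⇒0≤j-i h))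
  where
  lemma : ∀ y z D₁ D₃ a → y * z * ((D₃ - a) - (D₁ - a)) ≡
    (y + z) * (D₁ - a) * (D₃ - a) + (a * (y + z) * (D₁ + D₃ - a) - ((y + z) * D₁ * D₃ - y * z * (D₃ - D₁)))
  lemma = solve-∀

pair-lower-ℤ : ∀ y z D₁ D₃ a {m₁ m₃} → m₁ ≡ D₁ - a → m₃ ≡ D₃ - a →
               + 1 ≤ (y + z) * D₁ * D₃ - y * z * (D₃ - D₁) + (+ 1 - a) * (y + z) * (D₁ + D₃ + (+ 1 - a)) →
               y * z * ((m₃ + + 1) - (m₁ + + 1)) < (y + z) * (m₁ + + 1) * (m₃ + + 1)
pair-lower-ℤ y z D₁ D₃ a m₁≡ m₃≡ h = subst₂ (λ m₁ m₃ → y * z * ((m₃ + + 1) - (m₁ + + 1)) < (y + z) * (m₁ + + 1) * (m₃ + + 1))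
  (sym m₁≡) (sym m₃≡) (<-by-gap _ (lemma y z D₁ D₃ a) h)
  where
  lemma : ∀ y z D₁ D₃ a → (y + z) * (D₁ - a + + 1) * (D₃ - a + + 1) ≡
    y * z * ((D₃ - a + + 1) - (D₁ - a + + 1)) + ((y + z) * D₁ * D₃ - y * z * (D₃ - D₁) + (+ 1 - a) * (y + z) * (D₁ + D₃ + (+ 1 - a)))
  lemma = solve-∀

+1≤-monoˡ-- : ∀ {a b} c → a + + 1 ≤ b → a - c + + 1 ≤ b - c
+1≤-monoˡ-- {a} {b} c h = subst (_≤ b - c) (lemma a c) (ℤP.+-monoˡ-≤ (- c) h)
  where
  lemma : ∀ a c → a + + 1 - c ≡ a - c + + 1
  lemma = solve-∀

weighted≤ : ∀ {E K W S D} → + 0 ≤ E → + 0 ≤ S → K ≤ W * S → E * W ≤ D - + 1 → E * K ≤ S * (D - + 1)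
weighted≤ {E} {K} {W} {S} {D} 0≤E 0≤S K≤ EW≤ = begin
  E * K             ≤⟨ *-monoˡ-≤-0≤ E 0≤E K≤ ⟩
  E * (W * S)       ≡⟨ ℤP.*-assoc E W S ⟨
  E * W * S         ≤⟨ *-monoʳ-≤-0≤ S 0≤S EW≤ ⟩
  (D - + 1) * S     ≡⟨ ℤP.*-comm (D - + 1) S ⟩
  S * (D - + 1)     ∎
  where open ℤP.≤-Reasoning

upper-positive : ∀ a c S D → a ≡ + 1 → c ≤ S * (D - + 1) → c ≤ a * S * (D - a)
upper-positive a c S D refl = subst (c ≤_) (cong (_* (D - + 1)) (sym (ℤP.*-identityˡ S)))

upper-negative : ∀ a E S D → a ≡ + 0 → + 0 ≤ E → - E ≤ a * S * (D - a)
upper-negative a E S D refl 0≤E = subst (- E ≤_) (sym (trans (cong (_* (D - + 0)) (ℤP.*-zeroˡ S)) (ℤP.*-zeroˡ (D - + 0))))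
  (ℤP.neg-mono-≤ 0≤E)

lower-positive : ∀ a c S D → a ≡ + 1 → + 1 ≤ c → + 1 ≤ c + (+ 1 - a) * S * (D + (+ 1 - a))
lower-positive a c S D refl 1≤c = ≤-by-gap _ (lemma c S D) (ℤP.i≤j⇒0≤j-i 1≤c)
  where
  lemma : ∀ c S D → c + (+ 1 - + 1) * S * (D + (+ 1 - + 1)) ≡ + 1 + (c - + 1)
  lemma = solve-∀

lower-negative : ∀ a E S D → a ≡ + 0 → E ≤ S * (D - + 1) → + 1 ≤ S → + 1 ≤ - E + (+ 1 - a) * S * (D + (+ 1 - a))
lower-negative a E S D refl E≤ 1≤S = ≤-by-gap _ (lemma E S D)
  (+-nonNeg (ℤP.i≤j⇒0≤j-i E≤) (+-nonNeg (1≤⇒0≤ 1≤S) (ℤP.i≤j⇒0≤j-i 1≤S)))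
  where
  lemma : ∀ E S D → - E + (+ 1 - + 0) * S * (D + (+ 1 - + 0)) ≡ + 1 + ((S * (D - + 1) - E) + (S + (S - + 1)))
  lemma = solve-∀

module RecurrencePlus (V Q u : ℤ) (1≤Q : + 1 ≤ Q) (Q≤V : Q ≤ V) (1≤u : + 1 ≤ u) where
  open Recurrence V (- Q) u public

  private
    0≤Q : + 0 ≤ Q
    0≤Q = 1≤⇒0≤ 1≤Q

    1≤V : + 1 ≤ V
    1≤V = ℤP.≤-trans 1≤Q Q≤V

    0≤V : + 0 ≤ V
    0≤V = 1≤⇒0≤ 1≤V

  gap-rec⁺ : ∀ j → gap (2 ℕ.+ j) ≡ V * gap (suc j) + Q * gap j
  gap-rec⁺ j = trans (gap-rec j) (lemma V Q (gap (suc j)) (gap j))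
    where
    lemma : ∀ V Q a b → V * a - (- Q) * b ≡ V * a + Q * b
    lemma = solve-∀

  gap-nonNeg : ∀ j → + 0 ≤ gap j
  gap-nonNeg zero = subst (+ 0 ≤_) (sym gap-zero) (1≤⇒0≤ 1≤u)
  gap-nonNeg (suc zero) = subst (+ 0 ≤_) (sym gap-one) (*-nonNeg (ℤP.i≤j⇒0≤j-i 1≤V) (1≤⇒0≤ 1≤u))
  gap-nonNeg (suc (suc j)) = subst (+ 0 ≤_) (sym (gap-rec⁺ j))
    (+-nonNeg (*-nonNeg 0≤V (gap-nonNeg (suc j))) (*-nonNeg 0≤Q (gap-nonNeg j)))

  V*gap≤gap : ∀ j → V * gap (suc j) ≤ gap (2 ℕ.+ j)
  V*gap≤gap j = ≤-by-gap (Q * gap j) (gap-rec⁺ j) (*-nonNeg 0≤Q (gap-nonNeg j))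

  Q*gap≤gap : ∀ j → Q * gap j ≤ gap (2 ℕ.+ j)
  Q*gap≤gap j = ≤-by-gap (V * gap (suc j)) (trans (gap-rec⁺ j) (ℤP.+-comm (V * gap (suc j)) (Q * gap j)))
    (*-nonNeg 0≤V (gap-nonNeg (suc j)))

  gap-suc-mono : ∀ j → gap (suc j) ≤ gap (2 ℕ.+ j)
  gap-suc-mono j = ℤP.≤-trans (i≤j*i 1≤V (gap-nonNeg (suc j))) (V*gap≤gap j)

  gap-mono₂ : ∀ j → gap j ≤ gap (2 ℕ.+ j)
  gap-mono₂ j = ℤP.≤-trans (i≤j*i 1≤Q (gap-nonNeg j)) (Q*gap≤gap j)

  1≤gap₂ : ∀ j → + 1 ≤ gap (2 ℕ.+ j)
  1≤gap₂ zero = ℤP.≤-trans (subst (+ 1 ≤_) (sym gap-zero) 1≤u) (gap-mono₂ 0)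
  1≤gap₂ (suc j) = ℤP.≤-trans (1≤gap₂ j) (gap-suc-mono (suc j))

  A-pos : ∀ j → + 1 ≤ A (suc j)
  A-pos zero = 1≤u
  A-pos (suc j) = ℤP.≤-trans (A-pos j) (≤-by-gap (gap (suc j)) (A-suc (suc j)) (gap-nonNeg (suc j)))

  A-nonNeg : ∀ j → + 0 ≤ A j
  A-nonNeg zero = ℤP.≤-refl
  A-nonNeg (suc j) = 1≤⇒0≤ (A-pos j)

  cassini-sign : ∀ j → (δE j ≡ + 1 × cassini j ≡ Q ^ j * (u * u)) ⊎ (δE j ≡ + 0 × cassini j ≡ - (Q ^ j * (u * u)))
  cassini-sign j with -^-parity Q j
  ... | inj₁ (even , eq) = inj₁ (even , trans (cassini-closed j) (cong (_* (u * u)) eq))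
  ... | inj₂ (odd , eq) = inj₂ (odd , trans (cassini-closed j) (trans (cong (_* (u * u)) eq) (sym (ℤP.neg-distribˡ-* (Q ^ j) (u * u)))))

  A-sum-nonNeg : ∀ j → + 0 ≤ A (suc j) + A (2 ℕ.+ j)
  A-sum-nonNeg j = +-nonNeg (A-nonNeg (suc j)) (A-nonNeg (2 ℕ.+ j))

  weight-pos : ∀ j → + 1 ≤ pair-weight j
  weight-pos j = ℤP.≤-trans (*-≥1 1≤V+Q (A-pos j))
    (≤-by-gap ((V - + 1) * A (2 ℕ.+ j)) (ℤP.+-comm ((V - + 1) * A (2 ℕ.+ j)) ((V - - Q) * A (suc j)))
      (*-nonNeg (ℤP.i≤j⇒0≤j-i 1≤V) (A-nonNeg (2 ℕ.+ j))))
    where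
    1≤V+Q : + 1 ≤ V - - Q
    1≤V+Q = ℤP.≤-trans 1≤V (≤-by-gap Q (cong (_+_ V) (ℤP.neg-involutive Q)) 0≤Q)

  weight≤ : ∀ j → pair-weight j ≤ (V + Q) * (A (suc j) + A (2 ℕ.+ j))
  weight≤ j = ≤-by-gap ((Q + + 1) * A (2 ℕ.+ j)) (lemma V Q (A (suc j)) (A (2 ℕ.+ j)))
    (*-nonNeg (+-nonNeg 0≤Q (+≤+ z≤n)) (A-nonNeg (2 ℕ.+ j)))
    where
    lemma : ∀ V Q y z → (V + Q) * (y + z) ≡ ((V - + 1) * z + (V - - Q) * y) + (Q + + 1) * z
    lemma = solve-∀

  cassini-magnitude-pos : ∀ j → + 1 ≤ Q ^ j * (u * u)
  cassini-magnitude-pos j = *-≥1 (^-≥1 1≤Q j) (*-≥1 1≤u 1≤u)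

  -- Q ^ j * (u * u) is |cassini j| and (V + Q) * (A (suc j) + A (2 + j)) bounds pair-weight j,
  -- so this is what makes the Cassini term small enough for the pair bound.
  CassiniBound : ℕ → Set
  CassiniBound j = Q ^ j * (u * u) * (V + Q) ≤ gap j + gap (2 ℕ.+ j) - + 1

  CassiniBound-suc : ∀ j → gap j ≤ gap (suc j) → CassiniBound j → CassiniBound (suc j)
  CassiniBound-suc j gap-mono bound = begin
    Q ^ suc j * (u * u) * (V + Q)        ≡⟨ lemma₁ Q (Q ^ j) (u * u) (V + Q) ⟩
    Q * (Q ^ j * (u * u) * (V + Q))      ≤⟨ *-monoˡ-≤-0≤ Q 0≤Q bound ⟩
    Q * (gap j + gap (2 ℕ.+ j) - + 1)    ≤⟨ ≤-by-gap _ (trans (cong (λ g → gap (suc j) + g - + 1) (gap-rec⁺ (suc j)))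
                                               (lemma₂ V Q (gap j) (gap (suc j)) (gap (2 ℕ.+ j))))
                                               (+-nonNeg (+-nonNeg (+-nonNeg (gap-nonNeg (suc j))
                                                 (*-nonNeg (ℤP.i≤j⇒0≤j-i Q≤V) (gap-nonNeg (2 ℕ.+ j))))
                                                 (*-nonNeg 0≤Q (ℤP.i≤j⇒0≤j-i gap-mono))) (ℤP.i≤j⇒0≤j-i 1≤Q)) ⟩
    gap (suc j) + gap (3 ℕ.+ j) - + 1    ∎
    where
    open ℤP.≤-Reasoning
    lemma₁ : ∀ Q P E W → Q * P * E * W ≡ Q * (P * E * W)
    lemma₁ = solve-∀
    lemma₂ : ∀ V Q a b c → b + (V * c + Q * b) - + 1 ≡
      Q * (a + c - + 1) + (b + (V - Q) * c + Q * (b - a) + (Q - + 1))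
    lemma₂ = solve-∀

  CassiniBound-all : + 2 ≤ V → CassiniBound 0 → ∀ j → CassiniBound j
  CassiniBound-all 2≤V c₀ zero = c₀
  CassiniBound-all 2≤V c₀ (suc zero) = CassiniBound-suc 0 gap₀≤gap₁ c₀
    where
    gap₀≤gap₁ : gap 0 ≤ gap 1
    gap₀≤gap₁ = subst₂ _≤_ (sym gap-zero) (sym gap-one)
      (i≤j*i (ℤP.≤-trans (+≤+ (s≤s z≤n)) (ℤP.+-monoˡ-≤ (- + 1) 2≤V)) (1≤⇒0≤ 1≤u))
  CassiniBound-all 2≤V c₀ (suc (suc j)) = CassiniBound-suc (suc j) (gap-suc-mono j) (CassiniBound-all 2≤V c₀ (suc j))

  CassiniBound-from₂ : CassiniBound 2 → ∀ j → CassiniBound (2 ℕ.+ j)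
  CassiniBound-from₂ c₂ zero = c₂
  CassiniBound-from₂ c₂ (suc j) = CassiniBound-suc (2 ℕ.+ j) (gap-suc-mono (suc j)) (CassiniBound-from₂ c₂ j)

  M : ℕ → ℤ
  M j = gap j - δE j

  M-nonNeg : ∀ j → + 0 ≤ M j
  M-nonNeg zero = ℤP.i≤j⇒0≤j-i (subst (+ 1 ≤_) (sym gap-zero) 1≤u)
  M-nonNeg (suc zero) = ℤP.i≤j⇒0≤j-i (gap-nonNeg 1)
  M-nonNeg (suc (suc j)) = ℤP.i≤j⇒0≤j-i (ℤP.≤-trans (δE≤1 j) (1≤gap₂ j))

  M-mono₂ : ∀ j → M j ≤ M (2 ℕ.+ j)
  M-mono₂ j = ℤP.+-monoˡ-≤ (- δE j) (gap-mono₂ j)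

  gap-growth₂ : ∀ j → gap (2 ℕ.+ j) + + 1 ≤ gap (4 ℕ.+ j)
  gap-growth₂ j = begin
    gap (2 ℕ.+ j) + + 1                       ≤⟨ ℤP.+-monoʳ-≤ (gap (2 ℕ.+ j)) (1≤gap₂ (suc j)) ⟩
    gap (2 ℕ.+ j) + gap (3 ℕ.+ j)             ≤⟨ ℤP.+-mono-≤ (i≤j*i 1≤Q (gap-nonNeg (2 ℕ.+ j))) (i≤j*i 1≤V (gap-nonNeg (3 ℕ.+ j))) ⟩
    Q * gap (2 ℕ.+ j) + V * gap (3 ℕ.+ j)     ≡⟨ trans (ℤP.+-comm (Q * gap (2 ℕ.+ j)) (V * gap (3 ℕ.+ j))) (sym (gap-rec⁺ (2 ℕ.+ j))) ⟩
    gap (4 ℕ.+ j)                             ∎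
    where open ℤP.≤-Reasoning

  M-growth : ∀ j → M (2 ℕ.+ j) + + 1 ≤ M (4 ℕ.+ j)
  M-growth j = +1≤-monoˡ-- {gap (2 ℕ.+ j)} {gap (4 ℕ.+ j)} (δE j) (gap-growth₂ j)

  defect-sign : ∀ j → (δE j ≡ + 1 × defect j ≡ Q ^ j * (u * u) * pair-weight j)
                    ⊎ (δE j ≡ + 0 × defect j ≡ - (Q ^ j * (u * u) * pair-weight j))
  defect-sign j with cassini-sign j
  ... | inj₁ (even , cassini≡) = inj₁ (even , trans (pair-defect j) (cong (_* pair-weight j) cassini≡))
  ... | inj₂ (odd , cassini≡) = inj₂ (odd , trans (pair-defect j)
          (trans (cong (_* pair-weight j) cassini≡) (sym (ℤP.neg-distribˡ-* (Q ^ j * (u * u)) (pair-weight j)))))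

  pair-upper⁺ : ∀ j → (δE j ≡ + 1 → CassiniBound j) →
    (A (suc j) + A (2 ℕ.+ j)) * M j * M (2 ℕ.+ j) ≤ A (suc j) * A (2 ℕ.+ j) * (M (2 ℕ.+ j) - M j)
  pair-upper⁺ j bound = pair-upper-ℤ (A (suc j)) (A (2 ℕ.+ j)) (gap j) (gap (2 ℕ.+ j)) (δE j) refl refl (by-sign (defect-sign j))
    where
    S D EK : ℤ
    S = A (suc j) + A (2 ℕ.+ j)
    D = gap j + gap (2 ℕ.+ j)
    EK = Q ^ j * (u * u) * pair-weight j
    by-sign : (δE j ≡ + 1 × defect j ≡ EK) ⊎ (δE j ≡ + 0 × defect j ≡ - EK) → defect j ≤ δE j * S * (D - δE j)
    by-sign (inj₁ (even , defect≡)) = subst (_≤ δE j * S * (D - δE j)) (sym defect≡) (upper-positive (δE j) EK S D even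
      (weighted≤ {W = V + Q} {D = D} (1≤⇒0≤ (cassini-magnitude-pos j)) (A-sum-nonNeg j) (weight≤ j) (bound even)))
    by-sign (inj₂ (odd , defect≡)) = subst (_≤ δE j * S * (D - δE j)) (sym defect≡) (upper-negative (δE j) EK S D odd
      (1≤⇒0≤ (*-≥1 (cassini-magnitude-pos j) (weight-pos j))))

  pair-lower⁺ : ∀ j → (δE j ≡ + 0 → CassiniBound j) →
    A (suc j) * A (2 ℕ.+ j) * ((M (2 ℕ.+ j) + + 1) - (M j + + 1)) < (A (suc j) + A (2 ℕ.+ j)) * (M j + + 1) * (M (2 ℕ.+ j) + + 1)
  pair-lower⁺ j bound = pair-lower-ℤ (A (suc j)) (A (2 ℕ.+ j)) (gap j) (gap (2 ℕ.+ j)) (δE j) refl refl (by-sign (defect-sign j))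
    where
    S D EK : ℤ
    S = A (suc j) + A (2 ℕ.+ j)
    D = gap j + gap (2 ℕ.+ j)
    EK = Q ^ j * (u * u) * pair-weight j
    by-sign : (δE j ≡ + 1 × defect j ≡ EK) ⊎ (δE j ≡ + 0 × defect j ≡ - EK) →
              + 1 ≤ defect j + (+ 1 - δE j) * S * (D + (+ 1 - δE j))
    by-sign (inj₁ (even , defect≡)) = subst (λ c → + 1 ≤ c + (+ 1 - δE j) * S * (D + (+ 1 - δE j))) (sym defect≡)
      (lower-positive (δE j) EK S D even (*-≥1 (cassini-magnitude-pos j) (weight-pos j)))
    by-sign (inj₂ (odd , defect≡)) = subst (λ c → + 1 ≤ c + (+ 1 - δE j) * S * (D + (+ 1 - δE j))) (sym defect≡)
      (lower-negative (δE j) EK S D odd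
        (weighted≤ {W = V + Q} {D = D} (1≤⇒0≤ (cassini-magnitude-pos j)) (A-sum-nonNeg j) (weight≤ j) (bound odd))
        (ℤP.≤-trans (A-pos j) (≤-by-gap (A (2 ℕ.+ j)) refl (A-nonNeg (2 ℕ.+ j)))))

module RecurrenceMinus (V Q u : ℤ) (1≤Q : + 1 ≤ Q) (Q+2≤V : Q + + 2 ≤ V) (1≤u : + 1 ≤ u) where
  open Recurrence V Q u public

  private
    0≤Q : + 0 ≤ Q
    0≤Q = 1≤⇒0≤ 1≤Q

    2≤V-Q : + 2 ≤ V - Q
    2≤V-Q = subst (_≤ V - Q) (lemma Q) (ℤP.+-monoˡ-≤ (- Q) Q+2≤V)
      where
      lemma : ∀ Q → Q + + 2 - Q ≡ + 2
      lemma = solve-∀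

    Q≤V-1 : Q ≤ V - + 1
    Q≤V-1 = ≤-by-gap (V - Q - + 1) (lemma V Q) (ℤP.≤-trans (+≤+ z≤n) (ℤP.+-monoˡ-≤ (- + 1) 2≤V-Q))
      where
      lemma : ∀ V Q → V - + 1 ≡ Q + (V - Q - + 1)
      lemma = solve-∀

    2≤V-1 : + 2 ≤ V - + 1
    2≤V-1 = ℤP.+-monoˡ-≤ (- + 1) (ℤP.≤-trans (ℤP.+-monoˡ-≤ (+ 2) 1≤Q) Q+2≤V)

  gap-geometric : ∀ j → + 1 ≤ gap j × (V - + 1) * gap j ≤ gap (suc j)
  gap-geometric zero = subst (+ 1 ≤_) (sym gap-zero) 1≤u , ℤP.≤-reflexive (trans (cong ((V - + 1) *_) gap-zero) (sym gap-one))
  gap-geometric (suc j) with gap-geometric j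
  ... | 1≤gap , grows = 1≤gap′ , ≤-by-gap (gap (suc j) - Q * gap j) (trans (gap-rec j) (lemma V Q (gap j) (gap (suc j))))
                           (ℤP.i≤j⇒0≤j-i (ℤP.≤-trans (*-monoʳ-≤-0≤ (gap j) (1≤⇒0≤ 1≤gap) Q≤V-1) grows))
    where
    lemma : ∀ V Q a b → V * b - Q * a ≡ (V - + 1) * b + (b - Q * a)
    lemma = solve-∀
    1≤gap′ : + 1 ≤ gap (suc j)
    1≤gap′ = ℤP.≤-trans 1≤gap (ℤP.≤-trans (i≤j*i (ℤP.≤-trans (+≤+ (s≤s z≤n)) 2≤V-1) (1≤⇒0≤ 1≤gap)) grows)

  1≤gap : ∀ j → + 1 ≤ gap j
  1≤gap j = proj₁ (gap-geometric j)

  gap-nonNeg : ∀ j → + 0 ≤ gap j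
  gap-nonNeg j = 1≤⇒0≤ (1≤gap j)

  gap-double : ∀ j → gap j + gap j ≤ gap (suc j)
  gap-double j = ℤP.≤-trans (≤-by-gap ((V - + 1 - + 2) * gap j) (lemma V (gap j)) (*-nonNeg (ℤP.i≤j⇒0≤j-i 2≤V-1) (gap-nonNeg j)))
                            (proj₂ (gap-geometric j))
    where
    lemma : ∀ V a → (V - + 1) * a ≡ a + a + (V - + 1 - + 2) * a
    lemma = solve-∀

  gap-mono : ∀ j → gap j ≤ gap (suc j)
  gap-mono j = ℤP.≤-trans (≤-by-gap (gap j) refl (gap-nonNeg j)) (gap-double j)

  A-pos : ∀ j → + 1 ≤ A (suc j)
  A-pos zero = 1≤u
  A-pos (suc j) = ℤP.≤-trans (A-pos j) (≤-by-gap (gap (suc j)) (A-suc (suc j)) (gap-nonNeg (suc j)))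

  A-nonNeg : ∀ j → + 0 ≤ A j
  A-nonNeg zero = ℤP.≤-refl
  A-nonNeg (suc j) = 1≤⇒0≤ (A-pos j)

  A-sum-nonNeg : ∀ j → + 0 ≤ A (suc j) + A (2 ℕ.+ j)
  A-sum-nonNeg j = +-nonNeg (A-nonNeg (suc j)) (A-nonNeg (2 ℕ.+ j))

  weight-pos : ∀ j → + 1 ≤ pair-weight j
  weight-pos j = ℤP.≤-trans (*-≥1 (ℤP.≤-trans (+≤+ (s≤s z≤n)) 2≤V-Q) (A-pos j))
    (≤-by-gap ((V - + 1) * A (2 ℕ.+ j)) (ℤP.+-comm ((V - + 1) * A (2 ℕ.+ j)) ((V - Q) * A (suc j)))
      (*-nonNeg (ℤP.≤-trans (+≤+ z≤n) 2≤V-1) (A-nonNeg (2 ℕ.+ j))))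

  weight≤ : ∀ j → pair-weight j ≤ (V + Q) * (A (suc j) + A (2 ℕ.+ j))
  weight≤ j = ≤-by-gap ((Q + + 1) * A (2 ℕ.+ j) + (Q + Q) * A (suc j)) (lemma V Q (A (suc j)) (A (2 ℕ.+ j)))
    (+-nonNeg (*-nonNeg (+-nonNeg 0≤Q (+≤+ z≤n)) (A-nonNeg (2 ℕ.+ j))) (*-nonNeg (+-nonNeg 0≤Q 0≤Q) (A-nonNeg (suc j))))
    where
    lemma : ∀ V Q y z → (V + Q) * (y + z) ≡ ((V - + 1) * z + (V - Q) * y) + ((Q + + 1) * z + (Q + Q) * y)
    lemma = solve-∀

  cassini-magnitude-pos : ∀ j → + 1 ≤ Q ^ j * (u * u)
  cassini-magnitude-pos j = *-≥1 (^-≥1 1≤Q j) (*-≥1 1≤u 1≤u)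

  CassiniBound : ℕ → Set
  CassiniBound j = Q ^ j * (u * u) * (V + Q) ≤ gap j + gap (2 ℕ.+ j) - + 1

  CassiniBound-suc : ∀ j → CassiniBound j → CassiniBound (suc j)
  CassiniBound-suc j bound = begin
    Q ^ suc j * (u * u) * (V + Q)        ≡⟨ lemma₁ Q (Q ^ j) (u * u) (V + Q) ⟩
    Q * (Q ^ j * (u * u) * (V + Q))      ≤⟨ *-monoˡ-≤-0≤ Q 0≤Q bound ⟩
    Q * (gap j + gap (2 ℕ.+ j) - + 1)    ≤⟨ ≤-by-gap _ (trans (cong (λ g → gap (suc j) + g - + 1) (gap-rec (suc j)))
                                               (lemma₂ V Q (gap j) (gap (suc j)) (gap (2 ℕ.+ j))))
                                               slack-nonNeg ⟩
    gap (suc j) + gap (3 ℕ.+ j) - + 1    ∎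
    where
    open ℤP.≤-Reasoning
    lemma₁ : ∀ Q P E W → Q * P * E * W ≡ Q * (P * E * W)
    lemma₁ = solve-∀
    lemma₂ : ∀ V Q a b c → b + (V * c - Q * b) - + 1 ≡ Q * (a + c - + 1) +
      ((V - Q) * (c - (V - + 1) * b) + (+ 3 + + 3 * (V - Q - + 2) + (V - Q - + 2) * Q + (V - Q - + 2) * (V - Q - + 2)) * b
        + Q * (b - a) + (Q - + 1))
    lemma₂ = solve-∀
    0≤V-Q-2 : + 0 ≤ V - Q - + 2
    0≤V-Q-2 = ℤP.i≤j⇒0≤j-i 2≤V-Q
    coefficient-nonNeg : + 0 ≤ + 3 + + 3 * (V - Q - + 2) + (V - Q - + 2) * Q + (V - Q - + 2) * (V - Q - + 2)
    coefficient-nonNeg = +-nonNeg (+-nonNeg (+-nonNeg (+≤+ {0} {3} z≤n) (*-nonNeg (+≤+ {0} {3} z≤n) 0≤V-Q-2)) (*-nonNeg 0≤V-Q-2 0≤Q))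
                           (*-nonNeg 0≤V-Q-2 0≤V-Q-2)
    slack-nonNeg : + 0 ≤ (V - Q) * (gap (2 ℕ.+ j) - (V - + 1) * gap (suc j))
      + (+ 3 + + 3 * (V - Q - + 2) + (V - Q - + 2) * Q + (V - Q - + 2) * (V - Q - + 2)) * gap (suc j)
      + Q * (gap (suc j) - gap j) + (Q - + 1)
    slack-nonNeg = +-nonNeg (+-nonNeg (+-nonNeg
      (*-nonNeg (ℤP.≤-trans (+≤+ z≤n) 2≤V-Q) (ℤP.i≤j⇒0≤j-i (proj₂ (gap-geometric (suc j)))))
      (*-nonNeg coefficient-nonNeg (gap-nonNeg (suc j))))
      (*-nonNeg 0≤Q (ℤP.i≤j⇒0≤j-i (gap-mono j)))) (ℤP.i≤j⇒0≤j-i 1≤Q)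

  CassiniBound-all : CassiniBound 0 → ∀ j → CassiniBound j
  CassiniBound-all c₀ zero = c₀
  CassiniBound-all c₀ (suc j) = CassiniBound-suc j (CassiniBound-all c₀ j)

  M : ℕ → ℤ
  M j = gap j - + 1

  M-nonNeg : ∀ j → + 0 ≤ M j
  M-nonNeg j = ℤP.i≤j⇒0≤j-i (1≤gap j)

  gap-mono₂ : ∀ j → gap j ≤ gap (2 ℕ.+ j)
  gap-mono₂ j = ℤP.≤-trans (gap-mono j) (gap-mono (suc j))

  M-mono₂ : ∀ j → M j ≤ M (2 ℕ.+ j)
  M-mono₂ j = ℤP.+-monoˡ-≤ (- + 1) (gap-mono₂ j)

  gap-growth₂ : ∀ j → gap (2 ℕ.+ j) + + 1 ≤ gap (4 ℕ.+ j)
  gap-growth₂ j = begin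
    gap (2 ℕ.+ j) + + 1               ≤⟨ ℤP.+-monoʳ-≤ (gap (2 ℕ.+ j)) (1≤gap (3 ℕ.+ j)) ⟩
    gap (2 ℕ.+ j) + gap (3 ℕ.+ j)     ≤⟨ ℤP.+-monoˡ-≤ (gap (3 ℕ.+ j)) (gap-mono (2 ℕ.+ j)) ⟩
    gap (3 ℕ.+ j) + gap (3 ℕ.+ j)     ≤⟨ gap-double (3 ℕ.+ j) ⟩
    gap (4 ℕ.+ j)                     ∎
    where open ℤP.≤-Reasoning

  M-growth : ∀ j → M (2 ℕ.+ j) + + 1 ≤ M (4 ℕ.+ j)
  M-growth j = +1≤-monoˡ-- {gap (2 ℕ.+ j)} {gap (4 ℕ.+ j)} (+ 1) (gap-growth₂ j)

  pair-upper⁻ : CassiniBound 0 → ∀ j →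
    (A (suc j) + A (2 ℕ.+ j)) * M j * M (2 ℕ.+ j) ≤ A (suc j) * A (2 ℕ.+ j) * (M (2 ℕ.+ j) - M j)
  pair-upper⁻ c₀ j = pair-upper-ℤ (A (suc j)) (A (2 ℕ.+ j)) (gap j) (gap (2 ℕ.+ j)) (+ 1) refl refl
    (upper-positive (+ 1) (defect j) S D refl
      (subst (_≤ S * (D - + 1)) (sym (trans (pair-defect j) (cong (_* pair-weight j) (cassini-closed j))))
        (weighted≤ {W = V + Q} {D = D} (1≤⇒0≤ (cassini-magnitude-pos j)) (A-sum-nonNeg j) (weight≤ j) (CassiniBound-all c₀ j))))
    where
    S D : ℤ
    S = A (suc j) + A (2 ℕ.+ j)
    D = gap j + gap (2 ℕ.+ j)

  pair-lower⁻ : ∀ j →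
    A (suc j) * A (2 ℕ.+ j) * ((M (2 ℕ.+ j) + + 1) - (M j + + 1)) < (A (suc j) + A (2 ℕ.+ j)) * (M j + + 1) * (M (2 ℕ.+ j) + + 1)
  pair-lower⁻ j = pair-lower-ℤ (A (suc j)) (A (2 ℕ.+ j)) (gap j) (gap (2 ℕ.+ j)) (+ 1) refl refl
    (lower-positive (+ 1) (defect j) (A (suc j) + A (2 ℕ.+ j)) (gap j + gap (2 ℕ.+ j)) refl
      (subst (+ 1 ≤_) (sym (trans (pair-defect j) (cong (_* pair-weight j) (cassini-closed j))))
        (*-≥1 (cassini-magnitude-pos j) (weight-pos j))))

-- Step bounds for the sums of 1/{rk}²

step-upper-ℤ : ∀ x y z a b {m₁ m₂} → m₁ ≡ y * y - x * x - a → m₂ ≡ z * z - y * y - b →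
  (y * y - x * z) * (x * z + y * y) + a * b + b * (x * x) ≤ a * (z * z) →
  m₁ * m₂ ≤ y * y * (m₂ - m₁)
step-upper-ℤ x y z a b m₁≡ m₂≡ h = subst₂ (λ m₁ m₂ → m₁ * m₂ ≤ y * y * (m₂ - m₁)) (sym m₁≡) (sym m₂≡)
  (≤-by-gap _ (lemma x y z a b) (ℤP.i≤j⇒0≤j-i h))
  where
  lemma : ∀ x y z a b → y * y * ((z * z - y * y - b) - (y * y - x * x - a)) ≡
    (y * y - x * x - a) * (z * z - y * y - b) + (a * (z * z) - ((y * y - x * z) * (x * z + y * y) + a * b + b * (x * x)))
  lemma = solve-∀

step-lower-ℤ : ∀ x y z a b {m₁ m₂} → m₁ ≡ y * y - x * x - a → m₂ ≡ z * z - y * y - b →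
  + 1 ≤ (y * y - x * z) * (x * z + y * y) + (+ 1 - a) * (z * z) - (+ 1 - b) * (x * x) + (+ 1 - a) * (+ 1 - b) →
  y * y * ((m₂ + + 1) - (m₁ + + 1)) < (m₁ + + 1) * (m₂ + + 1)
step-lower-ℤ x y z a b m₁≡ m₂≡ h = subst₂ (λ m₁ m₂ → y * y * ((m₂ + + 1) - (m₁ + + 1)) < (m₁ + + 1) * (m₂ + + 1)) (sym m₁≡) (sym m₂≡)
  (<-by-gap _ (lemma x y z a b) h)
  where
  lemma : ∀ x y z a b → (y * y - x * x - a + + 1) * (z * z - y * y - b + + 1) ≡
    y * y * ((z * z - y * y - b + + 1) - (y * y - x * x - a + + 1)) +
    ((y * y - x * z) * (x * z + y * y) + (+ 1 - a) * (z * z) - (+ 1 - b) * (x * x) + (+ 1 - a) * (+ 1 - b))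
  lemma = solve-∀

step-upper-10 : ∀ c X Z a b → a ≡ + 1 → b ≡ + 0 → c ≤ Z → c + a * b + b * X ≤ a * Z
step-upper-10 c X Z a b refl refl = subst₂ _≤_ (lemma c X) (lemma′ Z)
  where
  lemma : ∀ c X → c ≡ c + + 1 * + 0 + + 0 * X
  lemma = solve-∀
  lemma′ : ∀ Z → Z ≡ + 1 * Z
  lemma′ = solve-∀

step-upper-01 : ∀ c X Z a b → a ≡ + 0 → b ≡ + 1 → c + X ≤ + 0 → c + a * b + b * X ≤ a * Z
step-upper-01 c X Z a b refl refl = subst₂ _≤_ (lemma c X) (lemma′ Z)
  where
  lemma : ∀ c X → c + X ≡ c + + 0 * + 1 + + 1 * X
  lemma = solve-∀
  lemma′ : ∀ Z → + 0 ≡ + 0 * Z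
  lemma′ = solve-∀

step-upper-11 : ∀ c X Z a b → a ≡ + 1 → b ≡ + 1 → c + + 1 + X ≤ Z → c + a * b + b * X ≤ a * Z
step-upper-11 c X Z a b refl refl = subst₂ _≤_ (lemma c X) (lemma′ Z)
  where
  lemma : ∀ c X → c + + 1 + X ≡ c + + 1 * + 1 + + 1 * X
  lemma = solve-∀
  lemma′ : ∀ Z → Z ≡ + 1 * Z
  lemma′ = solve-∀

step-lower-10 : ∀ c X Z a b → a ≡ + 1 → b ≡ + 0 → + 1 ≤ c - X → + 1 ≤ c + (+ 1 - a) * Z - (+ 1 - b) * X + (+ 1 - a) * (+ 1 - b)
step-lower-10 c X Z a b refl refl = subst (+ 1 ≤_) (lemma c X Z)
  where
  lemma : ∀ c X Z → c - X ≡ c + (+ 1 - + 1) * Z - (+ 1 - + 0) * X + (+ 1 - + 1) * (+ 1 - + 0)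
  lemma = solve-∀

step-lower-01 : ∀ c X Z a b → a ≡ + 0 → b ≡ + 1 → + 1 ≤ c + Z → + 1 ≤ c + (+ 1 - a) * Z - (+ 1 - b) * X + (+ 1 - a) * (+ 1 - b)
step-lower-01 c X Z a b refl refl = subst (+ 1 ≤_) (lemma c X Z)
  where
  lemma : ∀ c X Z → c + Z ≡ c + (+ 1 - + 0) * Z - (+ 1 - + 1) * X + (+ 1 - + 0) * (+ 1 - + 1)
  lemma = solve-∀

step-lower-11 : ∀ c X Z a b → a ≡ + 1 → b ≡ + 1 → + 1 ≤ c → + 1 ≤ c + (+ 1 - a) * Z - (+ 1 - b) * X + (+ 1 - a) * (+ 1 - b)
step-lower-11 c X Z a b refl refl = subst (+ 1 ≤_) (lemma c X Z)
  where
  lemma : ∀ c X Z → c ≡ c + (+ 1 - + 1) * Z - (+ 1 - + 1) * X + (+ 1 - + 1) * (+ 1 - + 1)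
  lemma = solve-∀

module SquareGaps (V q u : ℤ)
  (A-pos : ∀ j → + 1 ≤ Recurrence.A V q u (suc j))
  (gap-nonNeg : ∀ j → + 0 ≤ Recurrence.gap V q u j)
  (gap-mono₂ : ∀ j → Recurrence.gap V q u j ≤ Recurrence.gap V q u (2 ℕ.+ j))
  (gap-growth₂ : ∀ j → Recurrence.gap V q u (2 ℕ.+ j) + + 1 ≤ Recurrence.gap V q u (4 ℕ.+ j))
  where
  open Recurrence V q u

  A-nonNeg : ∀ j → + 0 ≤ A j
  A-nonNeg zero = ℤP.≤-refl
  A-nonNeg (suc j) = 1≤⇒0≤ (A-pos j)

  A-mono : ∀ j → A j ≤ A (suc j)
  A-mono j = ≤-by-gap (gap j) (A-suc j) (gap-nonNeg j)

  A-mono₂ : ∀ j → A j ≤ A (2 ℕ.+ j)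
  A-mono₂ j = ℤP.≤-trans (A-mono j) (A-mono (suc j))

  neighbour-sum : ℕ → ℤ
  neighbour-sum j = A (suc j) + A j

  1≤neighbour-sum : ∀ j → + 1 ≤ neighbour-sum j
  1≤neighbour-sum j = ℤP.≤-trans (A-pos j) (≤-by-gap (A j) refl (A-nonNeg j))

  neighbour-sum-mono₂ : ∀ j → neighbour-sum j ≤ neighbour-sum (2 ℕ.+ j)
  neighbour-sum-mono₂ j = ℤP.+-mono-≤ (A-mono₂ (suc j)) (A-mono₂ j)

  square-gap : ℕ → ℤ
  square-gap j = A (suc j) * A (suc j) - A j * A j

  square-gap≡ : ∀ j → square-gap j ≡ gap j * neighbour-sum j
  square-gap≡ j = lemma (A j) (A (suc j))
    where
    lemma : ∀ x y → y * y - x * x ≡ (y - x) * (y + x)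
    lemma = solve-∀

  gap≤square-gap : ∀ j → gap j ≤ square-gap j
  gap≤square-gap j = subst (gap j ≤_) (sym (square-gap≡ j))
    (subst (_≤ gap j * neighbour-sum j) (ℤP.*-identityʳ (gap j)) (*-monoˡ-≤-0≤ (gap j) (gap-nonNeg j) (1≤neighbour-sum j)))

  square-gap-mono : (∀ j → gap j ≤ gap (suc j)) → ∀ j → square-gap j ≤ square-gap (suc j)
  square-gap-mono gap-mono j = subst₂ _≤_ (sym (square-gap≡ j)) (sym (square-gap≡ (suc j)))
    (ℤP.≤-trans (*-monoʳ-≤-0≤ (neighbour-sum j) (1≤⇒0≤ (1≤neighbour-sum j)) (gap-mono j))
                (*-monoˡ-≤-0≤ (gap (suc j)) (gap-nonNeg (suc j)) (ℤP.+-mono-≤ (A-mono (suc j)) (A-mono j))))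

  square-gap-mono₂ : ∀ j → square-gap j ≤ square-gap (2 ℕ.+ j)
  square-gap-mono₂ j = subst₂ _≤_ (sym (square-gap≡ j)) (sym (square-gap≡ (2 ℕ.+ j)))
    (ℤP.≤-trans (*-monoʳ-≤-0≤ (neighbour-sum j) (1≤⇒0≤ (1≤neighbour-sum j)) (gap-mono₂ j))
                (*-monoˡ-≤-0≤ (gap (2 ℕ.+ j)) (gap-nonNeg (2 ℕ.+ j)) (neighbour-sum-mono₂ j)))

  square-gap-growth₂ : ∀ j → square-gap (2 ℕ.+ j) + + 1 ≤ square-gap (4 ℕ.+ j)
  square-gap-growth₂ j = begin
    square-gap (2 ℕ.+ j) + + 1            ≡⟨ cong (_+ + 1) (square-gap≡ (2 ℕ.+ j)) ⟩
    gap (2 ℕ.+ j) * S + + 1               ≤⟨ ℤP.+-monoʳ-≤ (gap (2 ℕ.+ j) * S) (1≤neighbour-sum (2 ℕ.+ j)) ⟩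
    gap (2 ℕ.+ j) * S + S                 ≡⟨ lemma (gap (2 ℕ.+ j)) S ⟩
    (gap (2 ℕ.+ j) + + 1) * S             ≤⟨ *-monoʳ-≤-0≤ S (1≤⇒0≤ (1≤neighbour-sum (2 ℕ.+ j))) (gap-growth₂ j) ⟩
    gap (4 ℕ.+ j) * S                     ≤⟨ *-monoˡ-≤-0≤ (gap (4 ℕ.+ j)) (gap-nonNeg (4 ℕ.+ j)) (neighbour-sum-mono₂ (2 ℕ.+ j)) ⟩
    gap (4 ℕ.+ j) * neighbour-sum (4 ℕ.+ j) ≡⟨ square-gap≡ (4 ℕ.+ j) ⟨
    square-gap (4 ℕ.+ j)                  ∎
    where
    open ℤP.≤-Reasoning
    S : ℤ
    S = neighbour-sum (2 ℕ.+ j)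
    lemma : ∀ a b → a * b + b ≡ (a + + 1) * b
    lemma = solve-∀

module SquaresPlus (V u : ℤ) (1≤V : + 1 ≤ V) (1≤u : + 1 ≤ u) (u≤V : u ≤ V) (2u²≤V²+1 : u * u + u * u ≤ V * V + + 1) where
  open RecurrencePlus V (+ 1) u ℤP.≤-refl 1≤V 1≤u public
  open SquareGaps V (- + 1) u A-pos gap-nonNeg gap-mono₂ gap-growth₂ public hiding (A-nonNeg)

  H : ℕ → ℤ
  H j = A j * A (2 ℕ.+ j) + A (suc j) * A (suc j)

  1≤u² : + 1 ≤ u * u
  1≤u² = *-≥1 1≤u 1≤u

  unit-cassini : ∀ j → (δE j ≡ + 1 × cassini j ≡ u * u) ⊎ (δE j ≡ + 0 × cassini j ≡ - (u * u))
  unit-cassini j with cassini-sign j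
  ... | inj₁ (even , cassini≡) = inj₁ (even , trans cassini≡ (1^*-identity j (u * u)))
  ... | inj₂ (odd , cassini≡) = inj₂ (odd , trans cassini≡ (cong -_ (1^*-identity j (u * u))))

  x²<u²H : ∀ j → A j * A j + + 1 ≤ u * u * H j
  x²<u²H j = ℤP.≤-trans (ℤP.+-mono-≤ (*-monoˡ-≤-0≤ (A j) (A-nonNeg j) (A-mono₂ j)) (*-≥1 (A-pos j) (A-pos j)))
    (i≤j*i 1≤u² (+-nonNeg (*-nonNeg (A-nonNeg j) (A-nonNeg (2 ℕ.+ j))) (*-nonNeg (A-nonNeg (suc j)) (A-nonNeg (suc j)))))

  u²H₀≤z² : u * u * H 0 ≤ A 2 * A 2
  u²H₀≤z² = ≤-by-gap (u * u * ((V - u) * (V + u))) (lemma V u)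
    (*-nonNeg (1≤⇒0≤ 1≤u²) (*-nonNeg (ℤP.i≤j⇒0≤j-i u≤V) (+-nonNeg (1≤⇒0≤ 1≤V) (1≤⇒0≤ 1≤u))))
    where
    lemma : ∀ V u → (V * u - (- + 1) * + 0) * (V * u - (- + 1) * + 0) ≡
      u * u * (+ 0 * (V * u - (- + 1) * + 0) + u * u) + u * u * ((V - u) * (V + u))
    lemma = solve-∀

  -- Multiplied by V, z² − u²H becomes a sum of nonnegative terms plus u²xy ≥ 1.
  u²H<z² : ∀ j → u * u * H (suc j) + + 1 ≤ A (3 ℕ.+ j) * A (3 ℕ.+ j)
  u²H<z² j = ≤-by-gap _ (lemma′ (u * u * H (suc j)) (A (3 ℕ.+ j) * A (3 ℕ.+ j)))
    (ℤP.i≤j⇒0≤j-i (1≤*⇒1≤ (1≤⇒0≤ 1≤V) (subst (+ 1 ≤_) (lemma V u X Y) positive)))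
    where
    X Y : ℤ
    X = A (suc j)
    Y = A (2 ℕ.+ j)
    lemma′ : ∀ a b → b ≡ a + + 1 + (b - a - + 1)
    lemma′ = solve-∀
    lemma : ∀ V u X Y → let Z = V * Y - (- + 1) * X in
      Y * Z * (V * V + + 1 - (u * u + u * u)) + (u * u - + 1) * (Y - V * X) * Z + u * u * X * Y
      ≡ V * (Z * Z - u * u * (X * Z + Y * Y))
    lemma = solve-∀
    positive : + 1 ≤ Y * A (3 ℕ.+ j) * (V * V + + 1 - (u * u + u * u)) + (u * u - + 1) * (Y - V * X) * A (3 ℕ.+ j) + u * u * X * Y
    positive = ℤP.≤-trans (*-≥1 (*-≥1 1≤u² (A-pos j)) (A-pos (suc j))) (≤-by-gap P (ℤP.+-comm P (u * u * X * Y)) 0≤P)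
      where
      P : ℤ
      P = Y * A (3 ℕ.+ j) * (V * V + + 1 - (u * u + u * u)) + (u * u - + 1) * (Y - V * X) * A (3 ℕ.+ j)
      VX≤Y : V * X ≤ Y
      VX≤Y = ≤-by-gap (A j) (lemma″ V X (A j)) (A-nonNeg j)
        where
        lemma″ : ∀ V X W → V * X - (- + 1) * W ≡ V * X + W
        lemma″ = solve-∀
      0≤P : + 0 ≤ P
      0≤P = +-nonNeg (*-nonNeg (*-nonNeg (A-nonNeg (2 ℕ.+ j)) (A-nonNeg (3 ℕ.+ j))) (ℤP.i≤j⇒0≤j-i 2u²≤V²+1))
                     (*-nonNeg (*-nonNeg (ℤP.i≤j⇒0≤j-i 1≤u²) (ℤP.i≤j⇒0≤j-i VX≤Y)) (A-nonNeg (3 ℕ.+ j)))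

  u²H≤z² : ∀ j → u * u * H j ≤ A (2 ℕ.+ j) * A (2 ℕ.+ j)
  u²H≤z² zero = u²H₀≤z²
  u²H≤z² (suc j) = ℤP.≤-trans (≤-by-gap (+ 1) refl (+≤+ z≤n)) (u²H<z² j)

  Msq : ℕ → ℤ
  Msq j = square-gap j - δE j

  Msq-nonNeg : ∀ j → + 0 ≤ Msq j
  Msq-nonNeg j = ℤP.≤-trans (M-nonNeg j) (ℤP.+-monoˡ-≤ (- δE j) (gap≤square-gap j))

  Msq-mono₂ : ∀ j → Msq j ≤ Msq (2 ℕ.+ j)
  Msq-mono₂ j = ℤP.+-monoˡ-≤ (- δE j) (square-gap-mono₂ j)

  Msq-growth : ∀ j → Msq (2 ℕ.+ j) + + 1 ≤ Msq (4 ℕ.+ j)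
  Msq-growth j = +1≤-monoˡ-- {square-gap (2 ℕ.+ j)} {square-gap (4 ℕ.+ j)} (δE j) (square-gap-growth₂ j)

  1≤Msq₂ : ∀ j → + 1 ≤ Msq (2 ℕ.+ j)
  1≤Msq₂ j = ℤP.≤-trans (ℤP.+-monoʳ-≤ (+ 2) (ℤP.neg-mono-≤ (δE≤1 j))) (ℤP.+-monoˡ-≤ (- δE j) 2≤square-gap)
    where
    2≤square-gap : + 2 ≤ square-gap (2 ℕ.+ j)
    2≤square-gap = subst (+ 2 ≤_) (sym (square-gap≡ (2 ℕ.+ j)))
      (ℤP.≤-trans (ℤP.+-mono-≤ (A-pos (2 ℕ.+ j)) (A-pos (suc j))) (i≤j*i (1≤gap₂ j) (1≤⇒0≤ (1≤neighbour-sum (2 ℕ.+ j)))))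

  Msq-pos-suc : ∀ j → + 1 ≤ Msq j → + 1 ≤ Msq (suc j)
  Msq-pos-suc zero 1≤Msq₀ with + 2 ℤP.≤? V
  ... | yes 2≤V = ℤP.≤-trans 1≤gap₁ (subst (gap 1 ≤_) (sym (ℤP.+-identityʳ (square-gap 1))) (gap≤square-gap 1))
    where
    1≤gap₁ : + 1 ≤ gap 1
    1≤gap₁ = subst (+ 1 ≤_) (sym gap-one) (*-≥1 (ℤP.+-monoˡ-≤ (- + 1) 2≤V) 1≤u)
  ... | no V≱2 = contradiction 1≤Msq₀ Msq₀≱1
    where
    V≡1 : V ≡ + 1
    V≡1 = ℤP.≤-antisym (ℤP.i<j⇒i≤pred[j] (ℤP.≰⇒> V≱2)) 1≤V
    u≡1 : u ≡ + 1
    u≡1 = ℤP.≤-antisym (subst (u ≤_) V≡1 u≤V) 1≤u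
    Msq₀≱1 : ¬ (+ 1 ≤ Msq 0)
    Msq₀≱1 1≤ with subst (λ u → + 1 ≤ u * u - + 0 * + 0 - + 1) u≡1 1≤
    ... | +≤+ ()
  Msq-pos-suc (suc j) _ = 1≤Msq₂ j

  private
    δE-after-even : ∀ j → δE j ≡ + 1 → δE (suc j) ≡ + 0
    δE-after-even j even = trans (δE-suc j) (cong (_-_ (+ 1)) even)

    δE-after-odd : ∀ j → δE j ≡ + 0 → δE (suc j) ≡ + 1
    δE-after-odd j odd = trans (δE-suc j) (cong (_-_ (+ 1)) odd)

    negated : ∀ j {c} → c ≡ - (u * u) → c * H j ≡ - (u * u * H j)
    negated j c≡ = trans (cong (_* H j) c≡) (sym (ℤP.neg-distribˡ-* (u * u) (H j)))

  step-upper : ∀ j → Msq j * Msq (suc j) ≤ A (suc j) * A (suc j) * (Msq (suc j) - Msq j)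
  step-upper j = step-upper-ℤ (A j) (A (suc j)) (A (2 ℕ.+ j)) (δE j) (δE (suc j)) refl refl (by-sign (unit-cassini j))
    where
    by-sign : (δE j ≡ + 1 × cassini j ≡ u * u) ⊎ (δE j ≡ + 0 × cassini j ≡ - (u * u)) →
      cassini j * H j + δE j * δE (suc j) + δE (suc j) * (A j * A j) ≤ δE j * (A (2 ℕ.+ j) * A (2 ℕ.+ j))
    by-sign (inj₁ (even , cassini≡)) = step-upper-10 (cassini j * H j) (A j * A j) (A (2 ℕ.+ j) * A (2 ℕ.+ j))
      (δE j) (δE (suc j)) even (δE-after-even j even)
      (subst (_≤ A (2 ℕ.+ j) * A (2 ℕ.+ j)) (cong (_* H j) (sym cassini≡)) (u²H≤z² j))
    by-sign (inj₂ (odd , cassini≡)) = step-upper-01 (cassini j * H j) (A j * A j) (A (2 ℕ.+ j) * A (2 ℕ.+ j))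
      (δE j) (δE (suc j)) odd (δE-after-odd j odd)
      (subst (λ c → c + A j * A j ≤ + 0) (sym (negated j cassini≡))
        (ℤP.≤-trans (ℤP.+-monoʳ-≤ (- (u * u * H j)) (ℤP.≤-trans (ℤP.i≤i+j (A j * A j) (+ 1)) (x²<u²H j)))
                    (ℤP.≤-reflexive (ℤP.+-inverseˡ (u * u * H j)))))

  step-lower : ∀ j → A (suc j) * A (suc j) * ((Msq (suc j) + + 1) - (Msq j + + 1)) < (Msq j + + 1) * (Msq (suc j) + + 1)
  step-lower j = step-lower-ℤ (A j) (A (suc j)) (A (2 ℕ.+ j)) (δE j) (δE (suc j)) refl refl (by-sign j (unit-cassini j))
    where
    by-sign : ∀ j → (δE j ≡ + 1 × cassini j ≡ u * u) ⊎ (δE j ≡ + 0 × cassini j ≡ - (u * u)) →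
      + 1 ≤ cassini j * H j + (+ 1 - δE j) * (A (2 ℕ.+ j) * A (2 ℕ.+ j)) - (+ 1 - δE (suc j)) * (A j * A j)
              + (+ 1 - δE j) * (+ 1 - δE (suc j))
    by-sign j (inj₁ (even , cassini≡)) = step-lower-10 (cassini j * H j) (A j * A j) (A (2 ℕ.+ j) * A (2 ℕ.+ j))
      (δE j) (δE (suc j)) even (δE-after-even j even)
      (subst (λ c → + 1 ≤ c - A j * A j) (cong (_* H j) (sym cassini≡))
        (subst (_≤ u * u * H j - A j * A j) (lemma (A j * A j)) (ℤP.+-monoˡ-≤ (- (A j * A j)) (x²<u²H j))))
      where
      lemma : ∀ a → a + + 1 - a ≡ + 1
      lemma = solve-∀
    by-sign zero (inj₂ (() , _))
    by-sign (suc j) (inj₂ (odd , cassini≡)) = step-lower-01 (cassini (suc j) * H (suc j)) (A (suc j) * A (suc j)) (A (3 ℕ.+ j) * A (3 ℕ.+ j))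
      (δE (suc j)) (δE (2 ℕ.+ j)) odd (δE-after-odd (suc j) odd)
      (subst (λ c → + 1 ≤ c + A (3 ℕ.+ j) * A (3 ℕ.+ j)) (sym (negated (suc j) cassini≡))
        (subst (_≤ - (u * u * H (suc j)) + A (3 ℕ.+ j) * A (3 ℕ.+ j)) (lemma (u * u * H (suc j)))
          (ℤP.+-monoʳ-≤ (- (u * u * H (suc j))) (u²H<z² j))))
      where
      lemma : ∀ a → - a + (a + + 1) ≡ + 1
      lemma = solve-∀

module SquaresMinus (V u : ℤ) (3≤V : + 1 + + 2 ≤ V) (1≤u : + 1 ≤ u) (2u+1≤V : u + u + + 1 ≤ V) where
  open RecurrenceMinus V (+ 1) u ℤP.≤-refl 3≤V 1≤u public
  open SquareGaps V (+ 1) u A-pos gap-nonNeg gap-mono₂ gap-growth₂ public hiding (A-nonNeg)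

  H : ℕ → ℤ
  H j = A j * A (2 ℕ.+ j) + A (suc j) * A (suc j)

  1≤u² : + 1 ≤ u * u
  1≤u² = *-≥1 1≤u 1≤u

  cassini≡u² : ∀ j → cassini j ≡ u * u
  cassini≡u² j = trans (cassini-closed j) (1^*-identity j (u * u))

  2uy≤z : ∀ j → + 2 * u * A (suc j) ≤ A (2 ℕ.+ j)
  2uy≤z j = begin
    + 2 * u * A (suc j)                       ≡⟨ lemma₁ u (A (suc j)) ⟩
    (u + u) * A (suc j)                       ≤⟨ *-monoʳ-≤-0≤ (A (suc j)) (A-nonNeg (suc j)) 2u≤V-1 ⟩
    (V - + 1) * A (suc j)                     ≤⟨ ≤-by-gap (A (suc j) - A j) refl (ℤP.i≤j⇒0≤j-i (A-mono j)) ⟩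
    (V - + 1) * A (suc j) + (A (suc j) - A j) ≡⟨ lemma₂ V (A j) (A (suc j)) ⟨
    A (2 ℕ.+ j)                               ∎
    where
    open ℤP.≤-Reasoning
    lemma₁ : ∀ u y → + 2 * u * y ≡ (u + u) * y
    lemma₁ = solve-∀
    lemma₂ : ∀ V x y → V * y - + 1 * x ≡ (V - + 1) * y + (y - x)
    lemma₂ = solve-∀
    2u≤V-1 : u + u ≤ V - + 1
    2u≤V-1 = subst (_≤ V - + 1) (lemma₃ u) (ℤP.+-monoˡ-≤ (- + 1) 2u+1≤V)
      where
      lemma₃ : ∀ u → u + u + + 1 - + 1 ≡ u + u
      lemma₃ = solve-∀

  cassini-product-bound : ∀ j → cassini j * H j + + 1 + A j * A j ≤ A (2 ℕ.+ j) * A (2 ℕ.+ j)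
  cassini-product-bound j = ≤-by-gap _ (lemma x y z) (+-nonNeg (+-nonNeg (+-nonNeg
    (subst (λ e → + 0 ≤ z * z - + 4 * e * (y * y)) (sym (cassini≡u² j)) (ℤP.i≤j⇒0≤j-i 4u²y²≤z²))
    (ℤP.i≤j⇒0≤j-i x²≤y²))
    (*-nonNeg (ℤP.i≤j⇒0≤j-i 1≤2ε) (*-nonNeg (A-nonNeg (suc j)) (A-nonNeg (suc j)))))
    (ℤP.i≤j⇒0≤j-i (*-≥1 1≤ε 1≤ε)))
    where
    x y z : ℤ
    x = A j
    y = A (suc j)
    z = A (2 ℕ.+ j)
    lemma : ∀ x y z → let ε = y * y - x * z in z * z ≡ ε * (x * z + y * y) + + 1 + x * x +
      ((z * z - + 4 * ε * (y * y)) + (y * y - x * x) + (+ 2 * ε - + 1) * (y * y) + (ε * ε - + 1))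
    lemma = solve-∀
    1≤ε : + 1 ≤ cassini j
    1≤ε = subst (+ 1 ≤_) (sym (cassini≡u² j)) 1≤u²
    1≤2ε : + 1 ≤ + 2 * cassini j
    1≤2ε = ℤP.≤-trans 1≤ε (i≤j*i (+≤+ {1} {2} (s≤s z≤n)) (1≤⇒0≤ 1≤ε))
    x²≤y² : x * x ≤ y * y
    x²≤y² = ℤP.≤-trans (*-monoˡ-≤-0≤ x (A-nonNeg j) (A-mono j)) (*-monoʳ-≤-0≤ y (A-nonNeg (suc j)) (A-mono j))
    4u²y²≤z² : + 4 * (u * u) * (y * y) ≤ z * z
    4u²y²≤z² = begin
      + 4 * (u * u) * (y * y)           ≡⟨ lemma′ u y ⟩
      (+ 2 * u * y) * (+ 2 * u * y)     ≤⟨ *-monoˡ-≤-0≤ (+ 2 * u * y) 0≤2uy (2uy≤z j) ⟩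
      (+ 2 * u * y) * z                 ≤⟨ *-monoʳ-≤-0≤ z (A-nonNeg (2 ℕ.+ j)) (2uy≤z j) ⟩
      z * z                             ∎
      where
      open ℤP.≤-Reasoning
      lemma′ : ∀ u y → + 4 * (u * u) * (y * y) ≡ (+ 2 * u * y) * (+ 2 * u * y)
      lemma′ = solve-∀
      0≤2uy : + 0 ≤ + 2 * u * y
      0≤2uy = *-nonNeg (*-nonNeg (+≤+ {0} {2} z≤n) (1≤⇒0≤ 1≤u)) (A-nonNeg (suc j))

  1≤H : ∀ j → + 1 ≤ H j
  1≤H j = ℤP.≤-trans (*-≥1 (A-pos j) (A-pos j))
    (≤-by-gap (A j * A (2 ℕ.+ j)) (ℤP.+-comm (A j * A (2 ℕ.+ j)) (A (suc j) * A (suc j))) (*-nonNeg (A-nonNeg j) (A-nonNeg (2 ℕ.+ j))))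

  Msq : ℕ → ℤ
  Msq j = square-gap j - + 1

  Msq-nonNeg : ∀ j → + 0 ≤ Msq j
  Msq-nonNeg j = ℤP.≤-trans (M-nonNeg j) (ℤP.+-monoˡ-≤ (- + 1) (gap≤square-gap j))

  Msq-mono : ∀ j → Msq j ≤ Msq (suc j)
  Msq-mono j = ℤP.+-monoˡ-≤ (- + 1) (square-gap-mono gap-mono j)

  Msq-mono₂ : ∀ j → Msq j ≤ Msq (2 ℕ.+ j)
  Msq-mono₂ j = ℤP.+-monoˡ-≤ (- + 1) (square-gap-mono₂ j)

  Msq-growth : ∀ j → Msq (2 ℕ.+ j) + + 1 ≤ Msq (4 ℕ.+ j)
  Msq-growth j = +1≤-monoˡ-- {square-gap (2 ℕ.+ j)} {square-gap (4 ℕ.+ j)} (+ 1) (square-gap-growth₂ j)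

  Msq-pos-suc : ∀ j → + 1 ≤ Msq j → + 1 ≤ Msq (suc j)
  Msq-pos-suc j 1≤Msq = ℤP.≤-trans 1≤Msq (Msq-mono j)

  step-upper : ∀ j → Msq j * Msq (suc j) ≤ A (suc j) * A (suc j) * (Msq (suc j) - Msq j)
  step-upper j = step-upper-ℤ (A j) (A (suc j)) (A (2 ℕ.+ j)) (+ 1) (+ 1) refl refl
    (step-upper-11 (cassini j * H j) (A j * A j) (A (2 ℕ.+ j) * A (2 ℕ.+ j)) (+ 1) (+ 1) refl refl (cassini-product-bound j))

  step-lower : ∀ j → A (suc j) * A (suc j) * ((Msq (suc j) + + 1) - (Msq j + + 1)) < (Msq j + + 1) * (Msq (suc j) + + 1)
  step-lower j = step-lower-ℤ (A j) (A (suc j)) (A (2 ℕ.+ j)) (+ 1) (+ 1) refl refl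
    (step-lower-11 (cassini j * H j) (A j * A j) (A (2 ℕ.+ j) * A (2 ℕ.+ j)) (+ 1) (+ 1) refl refl
      (*-≥1 (subst (+ 1 ≤_) (sym (cassini≡u² j)) 1≤u²) (1≤H j)))

FloorInvSum-relink : ∀ {f g : ℕ → ℚ} {n m m′} → (∀ i → g i ≡ f (suc (i ℕ.+ n))) → m ≡ m′ →
                     FloorInvSum g 0 m → FloorInvSum f (suc n) m′
FloorInvSum-relink {f} {g} {n} {m} g≗ refl = FloorInvSum-shift {f} {g} {suc n} {m} (λ i → trans (g≗ i) (cong f (sym (ℕP.+-suc i n))))

module ReciprocalFloor (B M : ℕ → ℤ)
  (B-pos : ∀ j → + 1 ≤ B (suc j))
  (M-nonNeg : ∀ j → + 0 ≤ M j)
  (M-mono₂ : ∀ j → M j ≤ M (2 ℕ.+ j))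
  (M-growth : ∀ j → M (2 ℕ.+ j) + + 1 ≤ M (4 ℕ.+ j))
  (pair-upper : ∀ j → + 1 ≤ M j → inv (B (suc j)) ℚ.+ inv (B (2 ℕ.+ j)) ℚ.≤ inv (M j) ℚ.- inv (M (2 ℕ.+ j)))
  (pair-lower : ∀ j → inv (M j + + 1) ℚ.- inv (M (2 ℕ.+ j) + + 1) ℚ.< inv (B (suc j)) ℚ.+ inv (B (2 ℕ.+ j)))
  where

  floorInvSum : ∀ n → FloorInvSum (λ i → inv (B (suc (i ℕ.+ n)))) 0 (M n)
  floorInvSum n = FloorCriterion.floorInvSum (λ i → inv (B (suc (i ℕ.+ n)))) (λ i → M (i ℕ.+ n))
    (λ i → inv-nonNeg (1≤⇒0≤ (B-pos (i ℕ.+ n))))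
    (λ i → M-nonNeg (i ℕ.+ n))
    (λ i → M-mono₂ (i ℕ.+ n))
    (λ i → M-growth (i ℕ.+ n))
    (λ i → pair-upper (i ℕ.+ n))
    (λ i → pair-lower (i ℕ.+ n))

module PairFloor (A M : ℕ → ℤ)
  (A-pos : ∀ j → + 1 ≤ A (suc j))
  (M-nonNeg : ∀ j → + 0 ≤ M j)
  (M-mono₂ : ∀ j → M j ≤ M (2 ℕ.+ j))
  (M-growth : ∀ j → M (2 ℕ.+ j) + + 1 ≤ M (4 ℕ.+ j))
  (pair-upper : ∀ j → + 1 ≤ M j →
    (A (suc j) + A (2 ℕ.+ j)) * M j * M (2 ℕ.+ j) ≤ A (suc j) * A (2 ℕ.+ j) * (M (2 ℕ.+ j) - M j))
  (pair-lower : ∀ j →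
    A (suc j) * A (2 ℕ.+ j) * ((M (2 ℕ.+ j) + + 1) - (M j + + 1)) < (A (suc j) + A (2 ℕ.+ j)) * (M j + + 1) * (M (2 ℕ.+ j) + + 1))
  where

  private
    1≤M+1 : ∀ j → + 1 ≤ M j + + 1
    1≤M+1 j = ℤP.+-monoˡ-≤ (+ 1) (M-nonNeg j)

  open ReciprocalFloor A M A-pos M-nonNeg M-mono₂ M-growth
    (λ j 1≤M → inv-+≤inv-- (A-pos j) (A-pos (suc j)) 1≤M (ℤP.≤-trans 1≤M (M-mono₂ j)) (pair-upper j 1≤M))
    (λ j → inv--<inv-+ (A-pos j) (A-pos (suc j)) (1≤M+1 j) (1≤M+1 (2 ℕ.+ j)) (pair-lower j))
    public

module StepFloor (A M : ℕ → ℤ)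
  (A-pos : ∀ j → + 1 ≤ A (suc j))
  (M-nonNeg : ∀ j → + 0 ≤ M j)
  (M-mono₂ : ∀ j → M j ≤ M (2 ℕ.+ j))
  (M-growth : ∀ j → M (2 ℕ.+ j) + + 1 ≤ M (4 ℕ.+ j))
  (M-pos-suc : ∀ j → + 1 ≤ M j → + 1 ≤ M (suc j))
  (step-upper : ∀ j → M j * M (suc j) ≤ A (suc j) * A (suc j) * (M (suc j) - M j))
  (step-lower : ∀ j → A (suc j) * A (suc j) * ((M (suc j) + + 1) - (M j + + 1)) < (M j + + 1) * (M (suc j) + + 1))
  where

  private
    B : ℕ → ℤ
    B k = A k * A k

    1≤B : ∀ j → + 1 ≤ B (suc j)
    1≤B j = *-≥1 (A-pos j) (A-pos j)

    1≤M+1 : ∀ j → + 1 ≤ M j + + 1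
    1≤M+1 j = ℤP.+-monoˡ-≤ (+ 1) (M-nonNeg j)

    inv-upper : ∀ j → + 1 ≤ M j → inv (B (suc j)) ℚ.≤ inv (M j) ℚ.- inv (M (suc j))
    inv-upper j 1≤M = inv≤inv-- (1≤B j) 1≤M (M-pos-suc j 1≤M) (step-upper j)

    inv-lower : ∀ j → inv (M j + + 1) ℚ.- inv (M (suc j) + + 1) ℚ.< inv (B (suc j))
    inv-lower j = inv--<inv (1≤B j) (1≤M+1 j) (1≤M+1 (suc j)) (step-lower j)

    pair-upper : ∀ j → + 1 ≤ M j → inv (B (suc j)) ℚ.+ inv (B (2 ℕ.+ j)) ℚ.≤ inv (M j) ℚ.- inv (M (2 ℕ.+ j))
    pair-upper j 1≤M = subst (inv (B (suc j)) ℚ.+ inv (B (2 ℕ.+ j)) ℚ.≤_) (telescope (inv (M j)) (inv (M (suc j))) (inv (M (2 ℕ.+ j))))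
      (ℚP.+-mono-≤ (inv-upper j 1≤M) (inv-upper (suc j) (M-pos-suc j 1≤M)))

    pair-lower : ∀ j → inv (M j + + 1) ℚ.- inv (M (2 ℕ.+ j) + + 1) ℚ.< inv (B (suc j)) ℚ.+ inv (B (2 ℕ.+ j))
    pair-lower j = subst (ℚ._< inv (B (suc j)) ℚ.+ inv (B (2 ℕ.+ j)))
      (telescope (inv (M j + + 1)) (inv (M (suc j) + + 1)) (inv (M (2 ℕ.+ j) + + 1)))
      (ℚP.+-mono-< (inv-lower j) (inv-lower (suc j)))

  open ReciprocalFloor B M 1≤B M-nonNeg M-mono₂ M-growth pair-upper pair-lower public

-- Size of {n}_{s,t} and of the Lucas companion

module _ {s t : ℤ} (1≤t : + 1 ≤ t) (t≤s : t ≤ s) where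

  private
    0≤t : + 0 ≤ t
    0≤t = 1≤⇒0≤ 1≤t

    1≤s : + 1 ≤ s
    1≤s = ℤP.≤-trans 1≤t t≤s

  U-bounds : ∀ j → + 0 ≤ U s t j × + 1 ≤ U s t (suc j)
  U-bounds zero = ℤP.≤-refl , ℤP.≤-refl
  U-bounds (suc j) with U-bounds j
  ... | 0≤U , 1≤U = 1≤⇒0≤ 1≤U , ℤP.≤-trans (*-≥1 1≤s 1≤U) (≤-by-gap (t * U s t j) refl (*-nonNeg 0≤t 0≤U))

  U-nonNeg : ∀ j → + 0 ≤ U s t j
  U-nonNeg j = proj₁ (U-bounds j)

  1≤U-suc : ∀ j → + 1 ≤ U s t (suc j)
  1≤U-suc j = proj₂ (U-bounds j)

  s*U≤U : ∀ j → s * U s t (suc j) ≤ U s t (2 ℕ.+ j)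
  s*U≤U j = ≤-by-gap (t * U s t j) refl (*-nonNeg 0≤t (U-nonNeg j))

  t^≤U : ∀ j → t ^ j ≤ U s t (suc j)
  t^≤U zero = ℤP.≤-refl
  t^≤U (suc j) = ℤP.≤-trans (*-monoˡ-≤-0≤ t 0≤t (t^≤U j))
    (ℤP.≤-trans (*-monoʳ-≤-0≤ (U s t (suc j)) (U-nonNeg (suc j)) t≤s) (s*U≤U j))

  s*U≤lucas : ∀ r′ → s * U s t (suc r′) ≤ lucas s t (suc r′)
  s*U≤lucas r′ = ≤-by-gap (t * U s t r′ + t * U s t r′) (lemma s t (U s t r′) (U s t (suc r′)))
    (+-nonNeg (*-nonNeg 0≤t (U-nonNeg r′)) (*-nonNeg 0≤t (U-nonNeg r′)))
    where
    lemma : ∀ s t p w → t * p + (s * w + t * p) ≡ s * w + (t * p + t * p)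
    lemma = solve-∀

  t^≤t²U : ∀ r″ → t ^ (2 ℕ.+ r″) ≤ t * t * U s t (suc r″)
  t^≤t²U r″ = subst (t ^ (2 ℕ.+ r″) ≤_) (sym (ℤP.*-assoc t t (U s t (suc r″))))
    (*-monoˡ-≤-0≤ t 0≤t (*-monoˡ-≤-0≤ t 0≤t (t^≤U r″)))

  t^+2≤lucas : ∀ r″ → t ^ (2 ℕ.+ r″) + + 2 ≤ lucas s t (2 ℕ.+ r″)
  t^+2≤lucas r″ = ≤-by-gap _ (lemma s t p w Q)
    (+-nonNeg (+-nonNeg (+-nonNeg (*-nonNeg (1≤⇒0≤ 1≤s) (ℤP.i≤j⇒0≤j-i (s*U≤U r″)))
                                  (*-nonNeg (*-nonNeg (ℤP.i≤j⇒0≤j-i t≤s) (+-nonNeg (1≤⇒0≤ 1≤s) 0≤t)) (U-nonNeg (suc r″))))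
                        (ℤP.i≤j⇒0≤j-i (t^≤t²U r″)))
              (*-nonNeg (+≤+ {0} {2} z≤n) (ℤP.i≤j⇒0≤j-i (*-≥1 1≤t (1≤U-suc r″)))))
    where
    p w Q : ℤ
    p = U s t (suc r″)
    w = U s t (2 ℕ.+ r″)
    Q = t ^ (2 ℕ.+ r″)
    lemma : ∀ s t p w Q → t * p + (s * w + t * p) ≡
      Q + + 2 + (s * (w - s * p) + (s - t) * (s + t) * p + (t * t * p - Q) + + 2 * (t * p - + 1))
    lemma = solve-∀


  lucas-initial : ∀ r″ q → q ≤ t ^ (2 ℕ.+ r″) → let w = U s t (2 ℕ.+ r″) ; V = lucas s t (2 ℕ.+ r″) in
    w * w * (V + t ^ (2 ℕ.+ r″)) ≤ w * (V * V - V - q + + 1) - + 1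
  lucas-initial r″ q q≤Q = ≤-by-gap _ (lemma s t p w Q q)
    (+-nonNeg (+-nonNeg (+-nonNeg (*-nonNeg 0≤w G-nonNeg) (ℤP.i≤j⇒0≤j-i 1≤w)) (*-nonNeg 0≤w (ℤP.i≤j⇒0≤j-i q≤Q)))
              (*-nonNeg (*-nonNeg 0≤w (+-nonNeg 0≤w (+≤+ z≤n))) (ℤP.i≤j⇒0≤j-i (t^≤t²U r″))))
    where
    p w Q G : ℤ
    p = U s t (suc r″)
    w = U s t (2 ℕ.+ r″)
    Q = t ^ (2 ℕ.+ r″)
    G = s * (s - + 1) * w * w + w * (s * (t * p - + 1) + t * p * (s - t)) + + 2 * t * p * (s - + 1) * w
        + t * p * (+ 3 * (t - + 1) + + 4 * t * (p - + 1) + + 1)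
    1≤w : + 1 ≤ w
    1≤w = 1≤U-suc (suc r″)
    0≤w 0≤p 0≤s-1 : + 0 ≤ _
    0≤w = 1≤⇒0≤ 1≤w
    0≤p = U-nonNeg (suc r″)
    0≤s-1 = ℤP.i≤j⇒0≤j-i 1≤s
    0≤tp : + 0 ≤ t * p
    0≤tp = *-nonNeg 0≤t 0≤p
    G-nonNeg : + 0 ≤ G
    G-nonNeg = +-nonNeg (+-nonNeg (+-nonNeg
      (*-nonNeg (*-nonNeg (*-nonNeg (1≤⇒0≤ 1≤s) 0≤s-1) 0≤w) 0≤w)
      (*-nonNeg 0≤w (+-nonNeg (*-nonNeg (1≤⇒0≤ 1≤s) (ℤP.i≤j⇒0≤j-i (*-≥1 1≤t (1≤U-suc r″)))) (*-nonNeg 0≤tp (ℤP.i≤j⇒0≤j-i t≤s)))))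
      (*-nonNeg (*-nonNeg (*-nonNeg (*-nonNeg (+≤+ {0} {2} z≤n) 0≤t) 0≤p) 0≤s-1) 0≤w))
      (*-nonNeg 0≤tp (+-nonNeg (+-nonNeg (*-nonNeg (+≤+ {0} {3} z≤n) (ℤP.i≤j⇒0≤j-i 1≤t))
                                         (*-nonNeg (*-nonNeg (+≤+ {0} {4} z≤n) 0≤t) (ℤP.i≤j⇒0≤j-i (1≤U-suc r″))))
                               (+≤+ {0} {1} z≤n)))
    lemma : ∀ s t p w Q q →
      let V = t * p + (s * w + t * p)
          G = s * (s - + 1) * w * w + w * (s * (t * p - + 1) + t * p * (s - t)) + + 2 * t * p * (s - + 1) * w
              + t * p * (+ 3 * (t - + 1) + + 4 * t * (p - + 1) + + 1)
      in w * (V * V - V - q + + 1) - + 1 ≡ w * w * (V + Q) + (w * G + (w - + 1) + w * (Q - q) + w * (w + + 1) * (t * t * p - Q))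
    lemma = solve-∀

Part1 : ℤ → ℤ → ℕ → ℕ → Set
Part1 s t r n = FloorInvSum (λ k → inv (U s t (r ℕ.* k))) (suc n) (U s t (r ℕ.* suc n) - U s t (r ℕ.* n) - δE (r ℕ.* n))

part1-relink : ∀ {s t r} (A M : ℕ → ℤ) → (∀ k → U s t (r ℕ.* k) ≡ A k) →
               (∀ j → M j ≡ A (suc j) - A j - δE (r ℕ.* j)) →
               ∀ n → FloorInvSum (λ i → inv (A (suc (i ℕ.+ n)))) 0 (M n) → Part1 s t r n
part1-relink {r = r} A M U≡A M≡ n = FloorInvSum-relink (λ i → cong inv (sym (U≡A (suc (i ℕ.+ n)))))
  (trans (M≡ n) (cong₂ (λ a b → a - b - δE (r ℕ.* n)) (sym (U≡A (suc n))) (sym (U≡A n))))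

module _ {s t : ℤ} (1≤t : + 1 ≤ t) (t≤s : t ≤ s) where

  part1-even : ∀ r″ → let r = 2 ℕ.+ r″ in δE r ≡ + 1 → (- t) ^ r ≡ t ^ r → ∀ n → Part1 s t r n
  part1-even r″ even power n = part1-relink {s} {t} {r} A M U≡A M≡ n
    (PairFloor.floorInvSum A M A-pos M-nonNeg M-mono₂ M-growth (λ j _ → pair-upper⁻ c₀ j) pair-lower⁻ n)
    where
    r : ℕ
    r = 2 ℕ.+ r″
    V Q u : ℤ
    V = lucas s t r
    Q = t ^ r
    u = U s t r
    open RecurrenceMinus V Q u (^-≥1 1≤t r) (t^+2≤lucas 1≤t t≤s r″) (1≤U-suc 1≤t t≤s (suc r″))
    U≡A : ∀ k → U s t (r ℕ.* k) ≡ A k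
    U≡A = subst (λ q → ∀ k → U s t (r ℕ.* k) ≡ Recurrence.A V q u k) power (U-multiple s t (suc r″))
    M≡ : ∀ j → M j ≡ A (suc j) - A j - δE (r ℕ.* j)
    M≡ j = cong (_-_ (gap j)) (sym (δE-*-even r even j))
    c₀ : CassiniBound 0
    c₀ = initial-cassini-bound Q (lucas-initial 1≤t t≤s r″ Q ℤP.≤-refl)

  part1-odd : ∀ r″ → let r = 2 ℕ.+ r″ in δE r ≡ + 0 → (- t) ^ r ≡ - (t ^ r) → ∀ n → Part1 s t r n
  part1-odd r″ odd power n = part1-relink {s} {t} {r} A M U≡A M≡ n
    (PairFloor.floorInvSum A M A-pos M-nonNeg M-mono₂ M-growth
      (λ j _ → pair-upper⁺ j (λ _ → CassiniBound-all 2≤V c₀ j)) (λ j → pair-lower⁺ j (λ _ → CassiniBound-all 2≤V c₀ j)) n)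
    where
    r : ℕ
    r = 2 ℕ.+ r″
    V Q u : ℤ
    V = lucas s t r
    Q = t ^ r
    u = U s t r
    0≤Q : + 0 ≤ Q
    0≤Q = 1≤⇒0≤ (^-≥1 1≤t r)
    open RecurrencePlus V Q u (^-≥1 1≤t r) (ℤP.≤-trans (ℤP.i≤i+j Q (+ 2)) (t^+2≤lucas 1≤t t≤s r″))
                              (1≤U-suc 1≤t t≤s (suc r″))
    2≤V : + 2 ≤ V
    2≤V = ℤP.≤-trans (ℤP.+-monoˡ-≤ (+ 2) 0≤Q) (t^+2≤lucas 1≤t t≤s r″)
    U≡A : ∀ k → U s t (r ℕ.* k) ≡ A k
    U≡A = subst (λ q → ∀ k → U s t (r ℕ.* k) ≡ Recurrence.A V q u k) power (U-multiple s t (suc r″))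
    M≡ : ∀ j → M j ≡ A (suc j) - A j - δE (r ℕ.* j)
    M≡ j = cong (_-_ (gap j)) (sym (δE-*-odd r odd j))
    c₀ : CassiniBound 0
    c₀ = initial-cassini-bound Q (lucas-initial 1≤t t≤s r″ (- Q) (ℤP.≤-trans (ℤP.neg-mono-≤ 0≤Q) 0≤Q))

  part1-one : + 2 ≤ s → ∀ n → Part1 s t 1 n
  part1-one 2≤s n = part1-relink {s} {t} {1} A M U≡A M≡ n
    (PairFloor.floorInvSum A M A-pos M-nonNeg M-mono₂ M-growth
      (λ j _ → pair-upper⁺ j (λ _ → CassiniBound-all 2≤V c₀ j)) (λ j → pair-lower⁺ j (λ _ → CassiniBound-all 2≤V c₀ j)) n)
    where
    V Q : ℤ
    V = lucas s t 1
    Q = t ^ 1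
    V≡s : V ≡ s
    V≡s = lemma s t
      where
      lemma : ∀ s t → t * + 0 + (s * + 1 + t * + 0) ≡ s
      lemma = solve-∀
    Q≡t : Q ≡ t
    Q≡t = ℤP.*-identityʳ t
    open RecurrencePlus V Q (+ 1) (subst (+ 1 ≤_) (sym Q≡t) 1≤t) (subst₂ _≤_ (sym Q≡t) (sym V≡s) t≤s) ℤP.≤-refl
    2≤V : + 2 ≤ V
    2≤V = subst (+ 2 ≤_) (sym V≡s) 2≤s
    U≡A : ∀ k → U s t (1 ℕ.* k) ≡ A k
    U≡A = subst (λ q → ∀ k → U s t (1 ℕ.* k) ≡ Recurrence.A V q (+ 1) k) (lemma t) (U-multiple s t 0)
      where
      lemma : ∀ t → (- t) * + 1 ≡ - (t * + 1)
      lemma = solve-∀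
    M≡ : ∀ j → M j ≡ A (suc j) - A j - δE (1 ℕ.* j)
    M≡ j = cong (_-_ (gap j)) (sym (δE-*-odd 1 refl j))
    c₀ : CassiniBound 0
    c₀ = initial-cassini-bound Q
      (≤-by-gap (s * (s - + 2)) (lemma s t) (*-nonNeg (ℤP.≤-trans (+≤+ z≤n) 2≤s) (ℤP.i≤j⇒0≤j-i 2≤s)))
      where
      lemma : ∀ s t → let V = t * + 0 + (s * + 1 + t * + 0) in
        + 1 * (V * V - V - - (t * + 1) + + 1) - + 1 ≡ + 1 * + 1 * (V + t * + 1) + s * (s - + 2)
      lemma = solve-∀

part1-fibonacci : ∀ n → Part1 (+ 1) (+ 1) 1 n
part1-fibonacci n = part1-relink {+ 1} {+ 1} {1} A M U≡A M≡ n
  (PairFloor.floorInvSum A M A-pos M-nonNeg M-mono₂ M-growth upper lower n)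
  where
  open RecurrencePlus (lucas (+ 1) (+ 1) 1) ((+ 1) ^ 1) (+ 1) ℤP.≤-refl ℤP.≤-refl ℤP.≤-refl
  U≡A : ∀ k → U (+ 1) (+ 1) (1 ℕ.* k) ≡ A k
  U≡A = U-multiple (+ 1) (+ 1) 0
  M≡ : ∀ j → M j ≡ A (suc j) - A j - δE (1 ℕ.* j)
  M≡ j = cong (_-_ (gap j)) (sym (δE-*-odd 1 refl j))
  -- Here the Cassini bound fails at j = 0 and 1, where A = 0, 1, 1, 2, 3: the first
  -- upper bound is vacuous (M 0 = 0) and the second lower bound reads 2 < 6.
  c₂ : CassiniBound 2
  c₂ = ℤP.≤-refl
  upper : ∀ j → + 1 ≤ M j →
    (A (suc j) + A (2 ℕ.+ j)) * M j * M (2 ℕ.+ j) ≤ A (suc j) * A (2 ℕ.+ j) * (M (2 ℕ.+ j) - M j)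
  upper zero (+≤+ ())
  upper (suc zero) _ = pair-upper⁺ 1 (λ ())
  upper (suc (suc j)) _ = pair-upper⁺ (2 ℕ.+ j) (λ _ → CassiniBound-from₂ c₂ j)
  lower : ∀ j →
    A (suc j) * A (2 ℕ.+ j) * ((M (2 ℕ.+ j) + + 1) - (M j + + 1)) < (A (suc j) + A (2 ℕ.+ j)) * (M j + + 1) * (M (2 ℕ.+ j) + + 1)
  lower zero = pair-lower⁺ 0 (λ ())
  lower (suc zero) = +<+ (s≤s (s≤s (s≤s z≤n)))
  lower (suc (suc j)) = pair-lower⁺ (2 ℕ.+ j) (λ _ → CassiniBound-from₂ c₂ j)

Part2 : ℤ → ℕ → ℕ → Set
Part2 s r n = FloorInvSum (λ k → inv (U s (+ 1) (r ℕ.* k) * U s (+ 1) (r ℕ.* k))) (suc n)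
  (U s (+ 1) (r ℕ.* suc n) * U s (+ 1) (r ℕ.* suc n) - U s (+ 1) (r ℕ.* n) * U s (+ 1) (r ℕ.* n) - δE (r ℕ.* n))

part2-relink : ∀ {s r} (A M : ℕ → ℤ) → (∀ k → U s (+ 1) (r ℕ.* k) ≡ A k) →
               (∀ j → M j ≡ A (suc j) * A (suc j) - A j * A j - δE (r ℕ.* j)) →
               ∀ n → FloorInvSum (λ i → inv (A (suc (i ℕ.+ n)) * A (suc (i ℕ.+ n)))) 0 (M n) → Part2 s r n
part2-relink {r = r} A M U≡A M≡ n = FloorInvSum-relink (λ i → cong (λ a → inv (a * a)) (sym (U≡A (suc (i ℕ.+ n)))))
  (trans (M≡ n) (cong₂ (λ a b → a * a - b * b - δE (r ℕ.* n)) (sym (U≡A (suc n))) (sym (U≡A n))))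

module _ {s : ℤ} (1≤s : + 1 ≤ s) where

  part2-even : ∀ r″ → let r = 2 ℕ.+ r″ in δE r ≡ + 1 → (- + 1) ^ r ≡ (+ 1) ^ r → ∀ n → Part2 s r n
  part2-even r″ even power n = part2-relink {s} {r} A Msq U≡A M≡ n
    (StepFloor.floorInvSum A Msq A-pos Msq-nonNeg Msq-mono₂ Msq-growth Msq-pos-suc step-upper step-lower n)
    where
    r : ℕ
    r = 2 ℕ.+ r″
    V u : ℤ
    V = lucas s (+ 1) r
    u = U s (+ 1) r
    one-power : (- + 1) ^ r ≡ + 1
    one-power = trans power (ℤP.^-zeroˡ r)
    1≤u : + 1 ≤ u
    1≤u = 1≤U-suc ℤP.≤-refl 1≤s (suc r″)
    3≤V : + 1 + + 2 ≤ V
    3≤V = subst (λ c → c + + 2 ≤ V) (ℤP.^-zeroˡ r) (t^+2≤lucas ℤP.≤-refl 1≤s r″)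
    -- V² = (s² + 4)u² + 4 > (2u)²
    2u+1≤V : u + u + + 1 ≤ V
    2u+1≤V = subst (_≤ V) (ℤP.+-comm (+ 1) (u + u)) (ℤP.i<j⇒suc[i]≤j (<-of-squares {u + u} {V} (ℤP.≤-trans (+≤+ z≤n) 3≤V)
      (ℤP.suc[i]≤j⇒i<j (≤-by-gap (s * s * u * u + + 3)
        (trans (lucas-square s (+ 1) (suc r″)) (trans (cong (λ c → (s * s + + 4 * + 1) * u * u + + 4 * c) one-power) (lemma s u)))
        (+-nonNeg (*-nonNeg (*-nonNeg (*-nonNeg (1≤⇒0≤ 1≤s) (1≤⇒0≤ 1≤s)) (1≤⇒0≤ 1≤u)) (1≤⇒0≤ 1≤u)) (+≤+ z≤n))))))
      where
      lemma : ∀ s u → (s * s + + 4 * + 1) * u * u + + 4 * + 1 ≡ + 1 + (u + u) * (u + u) + (s * s * u * u + + 3)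
      lemma = solve-∀
    open SquaresMinus V u 3≤V 1≤u 2u+1≤V
    U≡A : ∀ k → U s (+ 1) (r ℕ.* k) ≡ A k
    U≡A = subst (λ q → ∀ k → U s (+ 1) (r ℕ.* k) ≡ Recurrence.A V q u k) one-power (U-multiple s (+ 1) (suc r″))
    M≡ : ∀ j → Msq j ≡ A (suc j) * A (suc j) - A j * A j - δE (r ℕ.* j)
    M≡ j = cong (_-_ (square-gap j)) (sym (δE-*-even r even j))

  part2-odd : ∀ r′ → let r = suc r′ in δE r ≡ + 0 → (- + 1) ^ r ≡ - (+ 1) ^ r → ∀ n → Part2 s r n
  part2-odd r′ odd power n = part2-relink {s} {r} A Msq U≡A M≡ n
    (StepFloor.floorInvSum A Msq A-pos Msq-nonNeg Msq-mono₂ Msq-growth Msq-pos-suc step-upper step-lower n)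
    where
    r : ℕ
    r = suc r′
    V u : ℤ
    V = lucas s (+ 1) r
    u = U s (+ 1) r
    one-power : (- + 1) ^ r ≡ - + 1
    one-power = trans power (cong -_ (ℤP.^-zeroˡ r))
    1≤u : + 1 ≤ u
    1≤u = 1≤U-suc ℤP.≤-refl 1≤s r′
    u≤V : u ≤ V
    u≤V = ℤP.≤-trans (i≤j*i 1≤s (1≤⇒0≤ 1≤u)) (s*U≤lucas ℤP.≤-refl 1≤s r′)
    2u²≤V²+1 : u * u + u * u ≤ V * V + + 1
    2u²≤V²+1 = ≤-by-gap ((s * s - + 1) * u * u + + 3 * (u * u - + 1))
      (trans (cong (_+ + 1) (trans (lucas-square s (+ 1) r′) (cong (λ c → (s * s + + 4 * + 1) * u * u + + 4 * c) one-power)))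
             (lemma s u))
      (+-nonNeg (*-nonNeg (*-nonNeg (ℤP.i≤j⇒0≤j-i (*-≥1 1≤s 1≤s)) (1≤⇒0≤ 1≤u)) (1≤⇒0≤ 1≤u))
                (*-nonNeg (+≤+ {0} {3} z≤n) (ℤP.i≤j⇒0≤j-i (*-≥1 1≤u 1≤u))))
      where
      lemma : ∀ s u → (s * s + + 4 * + 1) * u * u + + 4 * - + 1 + + 1 ≡ u * u + u * u + ((s * s - + 1) * u * u + + 3 * (u * u - + 1))
      lemma = solve-∀
    open SquaresPlus V u (ℤP.≤-trans 1≤u u≤V) 1≤u u≤V 2u²≤V²+1
    U≡A : ∀ k → U s (+ 1) (r ℕ.* k) ≡ A k
    U≡A = subst (λ q → ∀ k → U s (+ 1) (r ℕ.* k) ≡ Recurrence.A V q u k) one-power (U-multiple s (+ 1) r′)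
    M≡ : ∀ j → Msq j ≡ A (suc j) * A (suc j) - A j * A j - δE (r ℕ.* j)
    M≡ j = cong (_-_ (square-gap j)) (sym (δE-*-odd r odd j))

part1 : (s t : ℤ) (n r : ℕ) → s ≥ t → t ≥ + 1 → 1 ℕ.≤ n → 1 ℕ.≤ r →
  FloorInvSum (λ k → inv (U s t (r ℕ.* k))) n (U s t (r ℕ.* n) - U s t (r ℕ.* (n ∸ 1)) - δE (r ℕ.* (n ∸ 1)))
part1 s t (suc n) (suc (suc r″)) t≤s 1≤t _ _ with -^-parity t (2 ℕ.+ r″)
... | inj₁ (even , power) = part1-even 1≤t t≤s r″ even power n
... | inj₂ (odd , power) = part1-odd 1≤t t≤s r″ odd power n
part1 s t (suc n) 1 t≤s 1≤t _ _ with + 2 ℤP.≤? s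
... | yes 2≤s = part1-one 1≤t t≤s 2≤s n
... | no s≱2 = subst₂ (λ s t → Part1 s t 1 n) (sym s≡1) (sym t≡1) (part1-fibonacci n)
  where
  s≤1 : s ℤ.≤ + 1
  s≤1 = ℤP.i<j⇒i≤pred[j] (ℤP.≰⇒> s≱2)
  s≡1 : s ≡ + 1
  s≡1 = ℤP.≤-antisym s≤1 (ℤP.≤-trans 1≤t t≤s)
  t≡1 : t ≡ + 1
  t≡1 = ℤP.≤-antisym (ℤP.≤-trans t≤s s≤1) 1≤t

part2 : (s : ℤ) (n r : ℕ) → s ≥ + 1 → 1 ℕ.≤ n → 1 ℕ.≤ r →
  FloorInvSum (λ k → inv (U s (+ 1) (r ℕ.* k) * U s (+ 1) (r ℕ.* k))) n
    (U s (+ 1) (r ℕ.* n) * U s (+ 1) (r ℕ.* n)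
      - U s (+ 1) (r ℕ.* (n ∸ 1)) * U s (+ 1) (r ℕ.* (n ∸ 1))
      - δE (r ℕ.* (n ∸ 1)))
part2 s (suc n) (suc r′) 1≤s _ _ with -^-parity (+ 1) (suc r′)
part2 s (suc n) (suc zero) 1≤s _ _ | inj₁ (() , _)
part2 s (suc n) (suc (suc r″)) 1≤s _ _ | inj₁ (even , power) = part2-even 1≤s r″ even power n
part2 s (suc n) (suc r′) 1≤s _ _ | inj₂ (odd , power) = part2-odd 1≤s r′ odd power n

theorem4p5 : ((s t : ℤ) (n r : ℕ) → s ≥ t → t ≥ + 1 → 1 ℕ.≤ n → 1 ℕ.≤ r →
    FloorInvSum (λ k → inv (U s t (r ℕ.* k))) n
      (U s t (r ℕ.* n) - U s t (r ℕ.* (n ∸ 1)) - δE (r ℕ.* (n ∸ 1))))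
  ×
  ((s : ℤ) (n r : ℕ) → s ≥ + 1 → 1 ℕ.≤ n → 1 ℕ.≤ r →
    FloorInvSum (λ k → inv (U s (+ 1) (r ℕ.* k) * U s (+ 1) (r ℕ.* k))) n
      (U s (+ 1) (r ℕ.* n) * U s (+ 1) (r ℕ.* n)
        - U s (+ 1) (r ℕ.* (n ∸ 1)) * U s (+ 1) (r ℕ.* (n ∸ 1))
        - δE (r ℕ.* (n ∸ 1))))
theorem4p5 = part1 , part2
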